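{- Let $M$ be a matroid and $t\in\mathbb{N}$. If $M$ is transversal, then so is $M^t$. If $M$ is cotransversal (that is, $M^*$ is transversal), then so is $M^t$.
   Context: A cyclic flat of a matroid $M$ is a flat $F$ such that $M|F$ has no coloops; $\mathcal{Z}(M)$ denotes the set of cyclic flats, and a matroid is determined by its cyclic flats and their ranks. The $t$-expansion: for each $e\in E(M)$ let $S_e$ be a $t$-element set with $e\in S_e$, the sets $S_e$ pairwise disjoint; for $X\subseteq E(M)$ let $S_X=\bigcup_{e\in X}S_e$. The $t$-expansion $M^t$ is the matroid on $S_{E(M)}$ whose cyclic flats are exactly the sets $S_A$ with $A\in\mathcal{Z}(M)$, with $r_{M^t}(S_A)=t\cdot r_M(A)$. A matroid is transversal if it is a matroid union of rank-$1$ matroids (equivalently, its independent sets are the partial transversals of a finite set system). -}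

module Defs where

open import Data.Nat using (ℕ; _+_; _*_; _∸_; _≤_; _<_)
open import Data.Fin using (Fin; remQuot)
open import Data.Fin.Subset using (Subset; _∈_; _∉_; _⊆_; _∪_; _∩_; ∁; ⁅_⁆; ⊤; ∣_∣)
open import Data.Vec using (tabulate; lookup)
open import Data.Product using (Σ; ∃; _×_; proj₁)
open import Relation.Binary.PropositionalEquality using (_≡_)

_∖ₑ_ : ∀ {n} → Subset n → Fin n → Subset n
X ∖ₑ e = X Data.Fin.Subset.─ ⁅ e ⁆

record Matroid (n : ℕ) : Set where
  field
    rank       : Subset n → ℕ
    rank-bound : ∀ X → rank X ≤ ∣ X ∣
    rank-mono  : ∀ X Y → X ⊆ Y → rank X ≤ rank Y
    rank-submod : ∀ X Y → rank (X ∪ Y) + rank (X ∩ Y) ≤ rank X + rank Y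
open Matroid public

dualRank : ∀ {n} → Matroid n → Subset n → ℕ
dualRank M X = (∣ X ∣ + rank M (∁ X)) ∸ rank M ⊤

PartialTransversal : ∀ {n k} → (Fin k → Subset n) → Subset n → Set
PartialTransversal {n} {k} A X =
  Σ (Fin n → Fin k) λ f →
    (∀ x → x ∈ X → x ∈ A (f x)) ×
    (∀ x y → x ∈ X → y ∈ X → f x ≡ f y → x ≡ y)

IsTransversal : ∀ {n} → (Subset n → ℕ) → Set
IsTransversal {n} r =
  Σ ℕ λ k → Σ (Fin k → Subset n) λ A →
    ∀ X → (r X ≡ ∣ X ∣ → PartialTransversal A X) ×
          (PartialTransversal A X → r X ≡ ∣ X ∣)

Transversal : ∀ {n} → Matroid n → Set
Transversal M = IsTransversal (rank M)

Cotransversal : ∀ {n} → Matroid n → Set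
Cotransversal M = IsTransversal (dualRank M)

IsFlat : ∀ {n} → Matroid n → Subset n → Set
IsFlat M F = ∀ e → e ∉ F → rank M F < rank M (F ∪ ⁅ e ⁆)

-- M|F has no coloops: removing any e ∈ F does not lower the rank.
IsCyclic : ∀ {n} → Matroid n → Subset n → Set
IsCyclic M F = ∀ e → e ∈ F → rank M (F ∖ₑ e) ≡ rank M F

IsCyclicFlat : ∀ {n} → Matroid n → Subset n → Set
IsCyclicFlat M F = IsFlat M F × IsCyclic M F

-- Ground set of the t-expansion: Fin (n * t), element j lying in the
-- block S_e where e = proj₁ (remQuot t j); S_X = ⋃_{e ∈ X} S_e.
S[_]_ : ∀ {n} (t : ℕ) → Subset n → Subset (n * t)
S[ t ] X = tabulate λ j → lookup X (proj₁ (remQuot t j))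

IsExpansion : ∀ {n} (t : ℕ) → Matroid n → Matroid (n * t) → Set
IsExpansion t M N =
  (∀ Z → IsCyclicFlat N Z → ∃ λ A → IsCyclicFlat M A × Z ≡ S[ t ] A) ×
  (∀ A → IsCyclicFlat M A → IsCyclicFlat N (S[ t ] A)) ×
  (∀ A → IsCyclicFlat M A → rank N (S[ t ] A) ≡ t * rank M A)

{-# OPTIONS --safe #-}

-- Take a presentation (A i)_{i < k} of M. Expanding every set A i to S_{A i} and taking each of these
-- t times gives a system B that presents N = M^t. Since every rank is attained at a cyclic flat,
-- r_M X = min_Z (r_M Z + ∣ X ─ Z ∣), the expansion satisfies r_N (S_X) = t · r_M X for every X.
-- An N-independent set satisfies Hall's condition for B, because a subset U meeting the blocks W
-- has at most r_N (S_W) = t · r_M W ≤ t · ∣ N_A W ∣ = ∣ N_B U ∣ elements; Hall's theorem (by Rado's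
-- reduction) then matches it. Conversely, if X is matched into B and S_Z is the cyclic flat of N
-- attaining r_N X, the deficiency form of Hall's theorem gives U ⊆ Z with ∣ Z ─ U ∣ + ∣ N_A U ∣ ≤ r_M Z,
-- which bounds ∣ X ∩ S_Z ∣ by t · r_M Z = r_N (S_Z), so X is independent. For the cotransversal
-- case, the cyclic flats of M* are the complements of those of M, so N* is the t-expansion of M*.

module Submission where

open import Defs
import Algebra.Lattice.Properties.BooleanAlgebra as BooleanAlgebraProperties
open import Data.Empty using (⊥-elim)
open import Data.Fin using (Fin; zero; suc; _≟_; _↑ˡ_; _↑ʳ_; splitAt; quotient; remainder; combine)
open import Data.Fin.Properties using (any?; splitAt-↑ˡ; splitAt-↑ʳ; splitAt⁻¹-↑ˡ; splitAt⁻¹-↑ʳ)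
open import Data.Fin.Subset
  using (Subset; _∈_; _∉_; _⊆_; _⊂_; _∪_; _∩_; _─_; _-_; ∁; ⁅_⁆; ⊤; ⊥; ∣_∣; inside; outside; Nonempty)
open import Data.Fin.Subset.Induction using (⊂-wellFounded)
open import Data.Fin.Subset.Properties
open import Data.Nat using (ℕ; zero; suc; _+_; _*_; _∸_; _≤_; _<_; z≤n; s≤s; _<?_; +-0-rawMonoid)
import Data.Nat as ℕ
open import Data.Nat.Properties hiding (_≟_)
open import Data.Nat.Tactic.RingSolver using (solve-∀)
open import Algebra.Definitions.RawMonoid +-0-rawMonoid using (sum)
open import Algebra.Properties.CommutativeSemigroup +-commutativeSemigroup using (interchange)
open import Data.Product using (∃; _×_; _,_; proj₁; proj₂)
open import Data.Sum using (_⊎_; inj₁; inj₂; [_,_]′)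
open import Data.Vec using ([]; _∷_; _++_; tabulate; lookup; replicate; here; there)
open import Data.Vec.Properties using (lookup∘tabulate; tabulate-cong; []=⇒lookup; lookup⇒[]=)
open import Function using (_∘_)
open import Induction.WellFounded using (WfRec; module All)
open import Level using (0ℓ)
open import Relation.Binary.PropositionalEquality
open import Relation.Nullary using (¬_; yes; no; does; ¬?)
open import Relation.Nullary.Decidable using (dec-true; decidable-stable; _×-dec_)
open import Relation.Unary using (Pred; Decidable)

private
  variable
    n k : ℕ

-- Finite subsets

subsetOf : {P : Pred (Fin n) 0ℓ} → Decidable P → Subset n
subsetOf P? = tabulate (λ x → does (P? x))

∈-subsetOf⁺ : {P : Pred (Fin n) 0ℓ} (P? : Decidable P) {x : Fin n} → P x → x ∈ subsetOf P?
∈-subsetOf⁺ P? {x} px = lookup⇒[]= x _ (trans (lookup∘tabulate _ x) (dec-true (P? x) px))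

∈-subsetOf⁻ : {P : Pred (Fin n) 0ℓ} (P? : Decidable P) {x : Fin n} → x ∈ subsetOf P? → P x
∈-subsetOf⁻ P? {x} x∈ with P? x | trans (sym (lookup∘tabulate (λ y → does (P? y)) x)) ([]=⇒lookup x∈)
... | yes px | _ = px
... | no _   | ()

x∈p─q⇒x∉q : {p q : Subset n} {x : Fin n} → x ∈ p ─ q → x ∉ q
x∈p─q⇒x∉q {p = _ ∷ _} {inside  ∷ _} (there x∈) (there x∈q) = x∈p─q⇒x∉q x∈ x∈q
x∈p─q⇒x∉q {p = _ ∷ _} {outside ∷ _} (there x∈) (there x∈q) = x∈p─q⇒x∉q x∈ x∈q

∣p∣≡∣p∩q∣+∣p─q∣ : (p q : Subset n) → ∣ p ∣ ≡ ∣ p ∩ q ∣ + ∣ p ─ q ∣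
∣p∣≡∣p∩q∣+∣p─q∣ []            []            = refl
∣p∣≡∣p∩q∣+∣p─q∣ (inside  ∷ p) (inside  ∷ q) = cong suc (∣p∣≡∣p∩q∣+∣p─q∣ p q)
∣p∣≡∣p∩q∣+∣p─q∣ (inside  ∷ p) (outside ∷ q) =
  trans (cong suc (∣p∣≡∣p∩q∣+∣p─q∣ p q)) (sym (+-suc _ _))
∣p∣≡∣p∩q∣+∣p─q∣ (outside ∷ p) (inside  ∷ q) = ∣p∣≡∣p∩q∣+∣p─q∣ p q
∣p∣≡∣p∩q∣+∣p─q∣ (outside ∷ p) (outside ∷ q) = ∣p∣≡∣p∩q∣+∣p─q∣ p q

∣p∪q∣+∣p∩q∣≡∣p∣+∣q∣ : (p q : Subset n) → ∣ p ∪ q ∣ + ∣ p ∩ q ∣ ≡ ∣ p ∣ + ∣ q ∣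
∣p∪q∣+∣p∩q∣≡∣p∣+∣q∣ []            []            = refl
∣p∪q∣+∣p∩q∣≡∣p∣+∣q∣ (inside  ∷ p) (inside  ∷ q) =
  cong suc (trans (+-suc _ _) (trans (cong suc (∣p∪q∣+∣p∩q∣≡∣p∣+∣q∣ p q)) (sym (+-suc _ _))))
∣p∪q∣+∣p∩q∣≡∣p∣+∣q∣ (inside  ∷ p) (outside ∷ q) = cong suc (∣p∪q∣+∣p∩q∣≡∣p∣+∣q∣ p q)
∣p∪q∣+∣p∩q∣≡∣p∣+∣q∣ (outside ∷ p) (inside  ∷ q) =
  trans (cong suc (∣p∪q∣+∣p∩q∣≡∣p∣+∣q∣ p q)) (sym (+-suc _ _))
∣p∪q∣+∣p∩q∣≡∣p∣+∣q∣ (outside ∷ p) (outside ∷ q) = ∣p∪q∣+∣p∩q∣≡∣p∣+∣q∣ p q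

∣p∪q∣≤∣p∣+∣q∣ : (p q : Subset n) → ∣ p ∪ q ∣ ≤ ∣ p ∣ + ∣ q ∣
∣p∪q∣≤∣p∣+∣q∣ p q = ≤-trans (m≤m+n _ _) (≤-reflexive (∣p∪q∣+∣p∩q∣≡∣p∣+∣q∣ p q))

p⊆q⇒∣q∣≡∣p∣+∣q─p∣ : {p q : Subset n} → p ⊆ q → ∣ q ∣ ≡ ∣ p ∣ + ∣ q ─ p ∣
p⊆q⇒∣q∣≡∣p∣+∣q─p∣ {p = p} {q} p⊆q = trans (∣p∣≡∣p∩q∣+∣p─q∣ q p) (cong (λ s → ∣ s ∣ + ∣ q ─ p ∣) q∩p≡p)
  where
  q∩p≡p : q ∩ p ≡ p
  q∩p≡p = ⊆-antisym (p∩q⊆q q p) (λ x∈p → x∈p∩q⁺ (p⊆q x∈p , x∈p))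

suc∣p-x∣≡∣p∣ : {p : Subset n} {x : Fin n} → x ∈ p → suc ∣ p - x ∣ ≡ ∣ p ∣
suc∣p-x∣≡∣p∣ {p = inside  ∷ p} here        = cong (suc ∘ ∣_∣) (p─⊥≡p p)
suc∣p-x∣≡∣p∣ {p = inside  ∷ p} (there x∈p) = cong suc (suc∣p-x∣≡∣p∣ x∈p)
suc∣p-x∣≡∣p∣ {p = outside ∷ p} (there x∈p) = suc∣p-x∣≡∣p∣ x∈p

∣p∪⁅x⁆∣≡suc∣p∣ : {p : Subset n} (x : Fin n) → x ∉ p → ∣ p ∪ ⁅ x ⁆ ∣ ≡ suc ∣ p ∣
∣p∪⁅x⁆∣≡suc∣p∣ {p = inside  ∷ p} zero    x∉p = ⊥-elim (x∉p here)
∣p∪⁅x⁆∣≡suc∣p∣ {p = outside ∷ p} zero    x∉p = cong (suc ∘ ∣_∣) (∪-identityʳ p)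
∣p∪⁅x⁆∣≡suc∣p∣ {p = inside  ∷ p} (suc x) x∉p = cong suc (∣p∪⁅x⁆∣≡suc∣p∣ x (x∉p ∘ there))
∣p∪⁅x⁆∣≡suc∣p∣ {p = outside ∷ p} (suc x) x∉p = ∣p∪⁅x⁆∣≡suc∣p∣ x (x∉p ∘ there)

∣p++q∣≡∣p∣+∣q∣ : ∀ {m} (p : Subset m) (q : Subset n) → ∣ p ++ q ∣ ≡ ∣ p ∣ + ∣ q ∣
∣p++q∣≡∣p∣+∣q∣ []            q = refl
∣p++q∣≡∣p∣+∣q∣ (inside  ∷ p) q = cong suc (∣p++q∣≡∣p∣+∣q∣ p q)
∣p++q∣≡∣p∣+∣q∣ (outside ∷ p) q = ∣p++q∣≡∣p∣+∣q∣ p q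

∈-++⁻ : ∀ {m} (p : Subset m) {q : Subset n} {x : Fin (m + n)} → x ∈ p ++ q →
        (∃ λ i → i ∈ p × x ≡ i ↑ˡ n) ⊎ (∃ λ j → j ∈ q × x ≡ m ↑ʳ j)
∈-++⁻ []      x∈q        = inj₂ (_ , x∈q , refl)
∈-++⁻ (_ ∷ p) here       = inj₁ (zero , here , refl)
∈-++⁻ (_ ∷ p) (there x∈) with ∈-++⁻ p x∈
... | inj₁ (i , i∈p , refl) = inj₁ (suc i , there i∈p , refl)
... | inj₂ (j , j∈q , refl) = inj₂ (j , j∈q , refl)

tabulate-++ : ∀ {A : Set} m (f : Fin (m + n) → A) →
              tabulate f ≡ tabulate (f ∘ (_↑ˡ n)) ++ tabulate (f ∘ (m ↑ʳ_))
tabulate-++ zero    f = refl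
tabulate-++ (suc m) f = cong (f zero ∷_) (tabulate-++ m (f ∘ suc))

tabulate-const : ∀ {A : Set} n (a : A) → tabulate {n = n} (λ _ → a) ≡ replicate n a
tabulate-const zero    a = refl
tabulate-const (suc n) a = cong (a ∷_) (tabulate-const n a)

x∈q⇒m↑ʳx∈p++q : ∀ {m} (p : Subset m) {q : Subset n} {x : Fin n} → x ∈ q → m ↑ʳ x ∈ p ++ q
x∈q⇒m↑ʳx∈p++q []      x∈q = x∈q
x∈q⇒m↑ʳx∈p++q (_ ∷ p) x∈q = there (x∈q⇒m↑ʳx∈p++q p x∈q)

p-x∪⁅x⁆≡p : {p : Subset n} {x : Fin n} → x ∈ p → (p - x) ∪ ⁅ x ⁆ ≡ p
p-x∪⁅x⁆≡p {p = p} {x} x∈p = ⊆-antisym ⊆p ⊇p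
  where
  ⊆p : (p - x) ∪ ⁅ x ⁆ ⊆ p
  ⊆p y∈ with x∈p∪q⁻ (p - x) ⁅ x ⁆ y∈
  ... | inj₁ y∈p-x = p─q⊆p p ⁅ x ⁆ y∈p-x
  ... | inj₂ y∈⁅x⁆ rewrite x∈⁅y⁆⇒x≡y x y∈⁅x⁆ = x∈p
  ⊇p : p ⊆ (p - x) ∪ ⁅ x ⁆
  ⊇p {y} y∈p with y ≟ x
  ... | yes refl = x∈p∪q⁺ (inj₂ (x∈⁅x⁆ x))
  ... | no y≢x   = x∈p∪q⁺ (inj₁ (x∈p∧x≢y⇒x∈p-y y∈p y≢x))

p∪⁅x⁆-x≡p : {p : Subset n} {x : Fin n} → x ∉ p → (p ∪ ⁅ x ⁆) - x ≡ p
p∪⁅x⁆-x≡p {p = p} {x} x∉p = ⊆-antisym ⊆p ⊇p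
  where
  ⊆p : (p ∪ ⁅ x ⁆) - x ⊆ p
  ⊆p {y} y∈ with x∈p∪q⁻ p ⁅ x ⁆ (p─q⊆p _ ⁅ x ⁆ y∈)
  ... | inj₁ y∈p   = y∈p
  ... | inj₂ y∈⁅x⁆ = ⊥-elim (x∈p─q⇒x∉q y∈ y∈⁅x⁆)
  ⊇p : p ⊆ (p ∪ ⁅ x ⁆) - x
  ⊇p {y} y∈p = x∈p∧x≢y⇒x∈p-y (x∈p∪q⁺ (inj₁ y∈p)) λ { refl → x∉p y∈p }

∁-─ : (p q : Subset n) → ∁ (p ─ q) ≡ ∁ p ∪ q
∁-─ []            []            = refl
∁-─ (inside  ∷ p) (inside  ∷ q) = cong (inside ∷_) (∁-─ p q)
∁-─ (inside  ∷ p) (outside ∷ q) = cong (outside ∷_) (∁-─ p q)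
∁-─ (outside ∷ p) (inside  ∷ q) = cong (inside ∷_) (∁-─ p q)
∁-─ (outside ∷ p) (outside ∷ q) = cong (inside ∷_) (∁-─ p q)

∁-∪ : (p q : Subset n) → ∁ (p ∪ q) ≡ ∁ p ─ q
∁-∪ []            []            = refl
∁-∪ (inside  ∷ p) (inside  ∷ q) = cong (outside ∷_) (∁-∪ p q)
∁-∪ (inside  ∷ p) (outside ∷ q) = cong (outside ∷_) (∁-∪ p q)
∁-∪ (outside ∷ p) (inside  ∷ q) = cong (outside ∷_) (∁-∪ p q)
∁-∪ (outside ∷ p) (outside ∷ q) = cong (inside ∷_) (∁-∪ p q)

∁-involutive : (p : Subset n) → ∁ (∁ p) ≡ p
∁-involutive {n} = BooleanAlgebraProperties.¬-involutive (∪-∩-booleanAlgebra n)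

∁p⊆∁q∪q─p : (p q : Subset n) → ∁ p ⊆ ∁ q ∪ (q ─ p)
∁p⊆∁q∪q─p p q {x} x∈∁p with x ∈? q
... | yes x∈q = x∈p∪q⁺ (inj₂ (x∈p∧x∉q⇒x∈p─q x∈q (x∈∁p⇒x∉p x∈∁p)))
... | no  x∉q = x∈p∪q⁺ (inj₁ (x∉p⇒x∈∁p x∉q))

─-antitoneʳ : (p : Subset n) {q q′ : Subset n} → q ⊆ q′ → p ─ q′ ⊆ p ─ q
─-antitoneʳ p q⊆q′ x∈ = x∈p∧x∉q⇒x∈p─q (p─q⊆p p _ x∈) (x∈p─q⇒x∉q x∈ ∘ q⊆q′)

p─[q-x]⊆p─q∪⁅x⁆ : (p q : Subset n) (x : Fin n) → p ─ (q - x) ⊆ (p ─ q) ∪ ⁅ x ⁆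
p─[q-x]⊆p─q∪⁅x⁆ p q x {y} y∈ with y ≟ x
... | yes refl = x∈p∪q⁺ (inj₂ (x∈⁅x⁆ y))
... | no  y≢x  = x∈p∪q⁺ (inj₁ (x∈p∧x∉q⇒x∈p─q (p─q⊆p p _ y∈)
                   (λ y∈q → x∈p─q⇒x∉q y∈ (x∈p∧x≢y⇒x∈p-y y∈q y≢x))))

0<∣p∣⇒nonempty : {p : Subset n} → 0 < ∣ p ∣ → Nonempty p
0<∣p∣⇒nonempty {n} {p} 0<∣p∣ with nonempty? p
... | yes p-nonempty = p-nonempty
... | no  p-empty    = ⊥-elim (<⇒≢ 0<∣p∣ (sym (trans (cong ∣_∣ (Empty-unique p-empty)) (∣⊥∣≡0 n))))

removal-induction : (P : Pred (Subset n) 0ℓ) → P ⊥ →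
                    (∀ {p x} → x ∈ p → P (p - x) → P p) → ∀ p → P p
removal-induction P P⊥ step = All.wfRec ⊂-wellFounded 0ℓ P go
  where
  go : ∀ p → WfRec _⊂_ P p → P p
  go p rec with nonempty? p
  ... | yes (x , x∈p) = step x∈p (rec (x∈p⇒p-x⊂p x∈p))
  ... | no  p-empty   = subst P (sym (Empty-unique p-empty)) P⊥

∃-minimal : {P : Pred (Subset n) 0ℓ} → Decidable P → (h : Subset n → ℕ) → ∀ {Z₀} → P Z₀ →
            ∃ λ Z → P Z × (∀ Z′ → P Z′ → h Z ≤ h Z′)
∃-minimal {P = P} P? h {Z₀} PZ₀ = descend (h Z₀) Z₀ PZ₀ ≤-refl
  where
  descend : ∀ m Z → P Z → h Z ≤ m → ∃ λ Z → P Z × (∀ Z′ → P Z′ → h Z ≤ h Z′)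
  descend m Z PZ hZ≤m with anySubset? (λ Z′ → P? Z′ ×-dec (h Z′ <? h Z))
  ... | no ∄smaller = Z , PZ , λ Z′ PZ′ → ≮⇒≥ (λ lt → ∄smaller (Z′ , PZ′ , lt))
  descend zero    Z PZ hZ≤0 | yes (Z′ , PZ′ , lt) = ⊥-elim (n≮0 (<-≤-trans lt hZ≤0))
  descend (suc m) Z PZ hZ≤m | yes (Z′ , PZ′ , lt) = descend m Z′ PZ′ (≤-pred (<-≤-trans lt hZ≤m))

InjectiveOn : (Fin n → Fin k) → Subset n → Set
InjectiveOn f p = ∀ x y → x ∈ p → y ∈ p → f x ≡ f y → x ≡ y

injection⇒∣p∣≤∣q∣ : (f : Fin n → Fin k) (p : Subset n) (q : Subset k) →
                    (∀ x → x ∈ p → f x ∈ q) → InjectiveOn f p → ∣ p ∣ ≤ ∣ q ∣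
injection⇒∣p∣≤∣q∣ {n} f = removal-induction P (λ _ _ _ → ≤-trans (≤-reflexive (∣⊥∣≡0 n)) z≤n) step
  where
  P : Pred (Subset _) 0ℓ
  P p = ∀ q → (∀ x → x ∈ p → f x ∈ q) → InjectiveOn f p → ∣ p ∣ ≤ ∣ q ∣
  step : ∀ {p x} → x ∈ p → P (p - x) → P p
  step {p} {x} x∈p IH q maps inj = begin
    ∣ p ∣             ≡⟨ suc∣p-x∣≡∣p∣ x∈p ⟨
    suc ∣ p - x ∣     ≤⟨ s≤s (IH (q - f x) maps′ inj′) ⟩
    suc ∣ q - f x ∣   ≡⟨ suc∣p-x∣≡∣p∣ (maps x x∈p) ⟩
    ∣ q ∣             ∎
    where
    open ≤-Reasoning
    in-p : ∀ {y} → y ∈ p - x → y ∈ p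
    in-p = p─q⊆p p ⁅ x ⁆
    maps′ : ∀ y → y ∈ p - x → f y ∈ q - f x
    maps′ y y∈ = x∈p∧x≢y⇒x∈p-y (maps y (in-p y∈))
      (λ fy≡fx → x∈p─q⇒x∉q y∈ (subst (_∈ ⁅ x ⁆) (sym (inj y x (in-p y∈) x∈p fy≡fx)) (x∈⁅x⁆ x)))
    inj′ : InjectiveOn f (p - x)
    inj′ y z y∈ z∈ = inj y z (in-p y∈) (in-p z∈)

-- Matroids

module MatroidProperties {n} (M : Matroid n) where

  private
    r = rank M

  r-mono : ∀ {X Y} → X ⊆ Y → r X ≤ r Y
  r-mono = rank-mono M _ _

  r[X∪Y]≤r[X]+∣Y∣ : ∀ X Y → r (X ∪ Y) ≤ r X + ∣ Y ∣
  r[X∪Y]≤r[X]+∣Y∣ X Y = begin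
    r (X ∪ Y)                 ≤⟨ m≤m+n _ _ ⟩
    r (X ∪ Y) + r (X ∩ Y)     ≤⟨ rank-submod M X Y ⟩
    r X + r Y                 ≤⟨ +-monoʳ-≤ (r X) (rank-bound M Y) ⟩
    r X + ∣ Y ∣               ∎
    where open ≤-Reasoning

  r[X∪⁅e⁆]≤suc-r[X] : ∀ X e → r (X ∪ ⁅ e ⁆) ≤ suc (r X)
  r[X∪⁅e⁆]≤suc-r[X] X e =
    ≤-trans (r[X∪Y]≤r[X]+∣Y∣ X ⁅ e ⁆) (≤-reflexive (trans (cong (r X +_) (∣⁅x⁆∣≡1 e)) (+-comm _ 1)))

  r[X]≤suc-r[X-e] : ∀ {X e} → e ∈ X → r X ≤ suc (r (X - e))
  r[X]≤suc-r[X-e] {X} {e} e∈X =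
    subst (λ Y → r Y ≤ suc (r (X - e))) (p-x∪⁅x⁆≡p e∈X) (r[X∪⁅e⁆]≤suc-r[X] (X - e) e)

  r[X]≤r[X∩Z]+∣X─Z∣ : ∀ X Z → r X ≤ r (X ∩ Z) + ∣ X ─ Z ∣
  r[X]≤r[X∩Z]+∣X─Z∣ X Z = ≤-trans (r-mono X⊆) (r[X∪Y]≤r[X]+∣Y∣ (X ∩ Z) (X ─ Z))
    where
    X⊆ : X ⊆ (X ∩ Z) ∪ (X ─ Z)
    X⊆ {x} x∈X with x ∈? Z
    ... | yes x∈Z = x∈p∪q⁺ (inj₁ (x∈p∩q⁺ (x∈X , x∈Z)))
    ... | no  x∉Z = x∈p∪q⁺ (inj₂ (x∈p∧x∉q⇒x∈p─q x∈X x∉Z))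

  r[X]≤r[Z]+∣X─Z∣ : ∀ X Z → r X ≤ r Z + ∣ X ─ Z ∣
  r[X]≤r[Z]+∣X─Z∣ X Z = ≤-trans (r[X]≤r[X∩Z]+∣X─Z∣ X Z) (+-monoˡ-≤ ∣ X ─ Z ∣ (r-mono (p∩q⊆q X Z)))

  independent⇒∣X∩Z∣≤r[Z] : ∀ {X} Z → r X ≡ ∣ X ∣ → ∣ X ∩ Z ∣ ≤ r Z
  independent⇒∣X∩Z∣≤r[Z] {X} Z indep = ≤-trans ∣X∩Z∣≤r[X∩Z] (r-mono (p∩q⊆q X Z))
    where
    ∣X∩Z∣≤r[X∩Z] : ∣ X ∩ Z ∣ ≤ r (X ∩ Z)
    ∣X∩Z∣≤r[X∩Z] = +-cancelʳ-≤ ∣ X ─ Z ∣ _ _ (begin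
      ∣ X ∩ Z ∣ + ∣ X ─ Z ∣   ≡⟨ ∣p∣≡∣p∩q∣+∣p─q∣ X Z ⟨
      ∣ X ∣                   ≡⟨ indep ⟨
      r X                     ≤⟨ r[X]≤r[X∩Z]+∣X─Z∣ X Z ⟩
      r (X ∩ Z) + ∣ X ─ Z ∣   ∎)
      where open ≤-Reasoning

  RankWitness : Subset n → Subset n → Set
  RankWitness X Z = r Z + ∣ X ─ Z ∣ ≤ r X

  potential : Subset n → Subset n → ℕ
  potential X Z = 3 * r Z + ∣ X ─ Z ∣ + ∣ ∁ Z ∣

  -- A witness of least potential is a cyclic flat: enlarging a non-flat witness, or removing a
  -- coloop from it, yields a witness of strictly smaller potential.
  module _ (X : Subset n) {Z : Subset n} (wZ : RankWitness X Z)
           (minimal : ∀ Z′ → RankWitness X Z′ → potential X Z ≤ potential X Z′) where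

    minimal-isFlat : IsFlat M Z
    minimal-isFlat e e∉Z with r Z <? r (Z ∪ ⁅ e ⁆)
    ... | yes grows  = grows
    ... | no  ¬grows = ⊥-elim (<⇒≱ smaller (minimal (Z ∪ ⁅ e ⁆) wZ′))
      where
      rZ′≤rZ : r (Z ∪ ⁅ e ⁆) ≤ r Z
      rZ′≤rZ = ≮⇒≥ ¬grows
      ─≤ : ∣ X ─ (Z ∪ ⁅ e ⁆) ∣ ≤ ∣ X ─ Z ∣
      ─≤ = p⊆q⇒∣p∣≤∣q∣ (─-antitoneʳ X (p⊆p∪q {p = Z} ⁅ e ⁆))
      wZ′ : RankWitness X (Z ∪ ⁅ e ⁆)
      wZ′ = ≤-trans (+-mono-≤ rZ′≤rZ ─≤) wZ
      ∁< : ∣ ∁ (Z ∪ ⁅ e ⁆) ∣ < ∣ ∁ Z ∣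
      ∁< = subst (λ W → ∣ W ∣ < ∣ ∁ Z ∣) (sym (∁-∪ Z ⁅ e ⁆)) (x∈p⇒∣p-x∣<∣p∣ (x∉p⇒x∈∁p e∉Z))
      smaller : potential X (Z ∪ ⁅ e ⁆) < potential X Z
      smaller = +-mono-≤-< (+-mono-≤ (*-monoʳ-≤ 3 rZ′≤rZ) ─≤) ∁<

    minimal-isCyclic : IsCyclic M Z
    minimal-isCyclic e e∈Z with r (Z - e) <? r Z
    ... | no  ¬drops = ≤-antisym (r-mono (p─q⊆p Z ⁅ e ⁆)) (≮⇒≥ ¬drops)
    ... | yes drops  = ⊥-elim (<⇒≱ smaller (minimal (Z - e) wZ′))
      where
      a = r (Z - e)
      b = ∣ X ─ Z ∣
      c = ∣ ∁ Z ∣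
      rZ≡suc-a : r Z ≡ suc a
      rZ≡suc-a = ≤-antisym (r[X]≤suc-r[X-e] e∈Z) drops
      ∣p∪⁅e⁆∣≤suc∣p∣ : ∀ p → ∣ p ∪ ⁅ e ⁆ ∣ ≤ suc ∣ p ∣
      ∣p∪⁅e⁆∣≤suc∣p∣ p = ≤-trans (∣p∪q∣≤∣p∣+∣q∣ p ⁅ e ⁆)
                                 (≤-reflexive (trans (cong (∣ p ∣ +_) (∣⁅x⁆∣≡1 e)) (+-comm _ 1)))
      ─≤ : ∣ X ─ (Z - e) ∣ ≤ suc b
      ─≤ = ≤-trans (p⊆q⇒∣p∣≤∣q∣ (p─[q-x]⊆p─q∪⁅x⁆ X Z e)) (∣p∪⁅e⁆∣≤suc∣p∣ (X ─ Z))
      ∁≤ : ∣ ∁ (Z - e) ∣ ≤ suc c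
      ∁≤ = subst (λ W → ∣ W ∣ ≤ suc c) (sym (∁-─ Z ⁅ e ⁆)) (∣p∪⁅e⁆∣≤suc∣p∣ (∁ Z))
      wZ′ : RankWitness X (Z - e)
      wZ′ = begin
        a + ∣ X ─ (Z - e) ∣   ≤⟨ +-monoʳ-≤ a ─≤ ⟩
        a + suc b             ≡⟨ +-suc a b ⟩
        suc a + b             ≡⟨ cong (_+ b) rZ≡suc-a ⟨
        r Z + b               ≤⟨ wZ ⟩
        r X                   ∎
        where open ≤-Reasoning
      arithmetic : ∀ a b c → suc (3 * a + suc b + suc c) ≡ 3 * suc a + b + c
      arithmetic = solve-∀
      smaller : potential X (Z - e) < potential X Z
      smaller = begin-strict
        3 * a + ∣ X ─ (Z - e) ∣ + ∣ ∁ (Z - e) ∣   ≤⟨ +-mono-≤ (+-monoʳ-≤ (3 * a) ─≤) ∁≤ ⟩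
        3 * a + suc b + suc c                    <⟨ ≤-reflexive (arithmetic a b c) ⟩
        3 * suc a + b + c                        ≡⟨ cong (λ w → 3 * w + b + c) rZ≡suc-a ⟨
        3 * r Z + b + c                          ∎
        where open ≤-Reasoning

  ∃-cyclicFlat-witness : ∀ X → ∃ λ Z → IsCyclicFlat M Z × RankWitness X Z
  ∃-cyclicFlat-witness X with ∃-minimal (λ Z → r Z + ∣ X ─ Z ∣ ≤? r X) (potential X) wX
    where
    ∣X─X∣≤0 : ∣ X ─ X ∣ ≤ 0
    ∣X─X∣≤0 = ≤-trans (p⊆q⇒∣p∣≤∣q∣ {q = ⊥} (λ x∈ → ⊥-elim (x∈p─q⇒x∉q x∈ (p─q⊆p X X x∈))))
                      (≤-reflexive (∣⊥∣≡0 n))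
    wX : RankWitness X X
    wX = ≤-trans (+-monoʳ-≤ (r X) ∣X─X∣≤0) (≤-reflexive (+-identityʳ _))
  ... | Z , wZ , minimal = Z , (minimal-isFlat X wZ minimal , minimal-isCyclic X wZ minimal) , wZ

  coloop-restrict : ∀ {Y F e} → Y ⊆ F → e ∈ Y → r (F - e) < r F → r (Y - e) < r Y
  coloop-restrict {Y} {F} {e} Y⊆F e∈Y drops = +-cancelˡ-< (r F) _ _ (begin-strict
    r F + r (Y - e)                     ≤⟨ +-mono-≤ (r-mono F⊆) (r-mono Y-e⊆) ⟩
    r (Y ∪ (F - e)) + r (Y ∩ (F - e))   ≤⟨ rank-submod M Y (F - e) ⟩
    r Y + r (F - e)                     <⟨ +-monoʳ-< (r Y) drops ⟩
    r Y + r F                           ≡⟨ +-comm (r Y) (r F) ⟩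
    r F + r Y                           ∎)
    where
    open ≤-Reasoning
    F⊆ : F ⊆ Y ∪ (F - e)
    F⊆ {x} x∈F with x ≟ e
    ... | yes refl = x∈p∪q⁺ (inj₁ e∈Y)
    ... | no  x≢e  = x∈p∪q⁺ (inj₂ (x∈p∧x≢y⇒x∈p-y x∈F x≢e))
    Y-e⊆ : Y - e ⊆ Y ∩ (F - e)
    Y-e⊆ x∈ = x∈p∩q⁺ (p─q⊆p Y _ x∈ , x∈p∧x∉q⇒x∈p─q (Y⊆F (p─q⊆p Y _ x∈)) (x∈p─q⇒x∉q x∈))

  coloops⇒independent : ∀ {I} → (∀ e → e ∈ I → r (I - e) < r I) → r I ≡ ∣ I ∣
  coloops⇒independent {I} coloops = ≤-antisym (rank-bound M I) (removal-induction P base step I ⊆-refl)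
    where
    P : Pred (Subset n) 0ℓ
    P Y = Y ⊆ I → ∣ Y ∣ ≤ r Y
    base : P ⊥
    base _ = ≤-trans (≤-reflexive (∣⊥∣≡0 n)) z≤n
    step : ∀ {Y e} → e ∈ Y → P (Y - e) → P Y
    step {Y} {e} e∈Y IH Y⊆I = begin
      ∣ Y ∣             ≡⟨ suc∣p-x∣≡∣p∣ e∈Y ⟨
      suc ∣ Y - e ∣     ≤⟨ s≤s (IH (⊆-trans (p─q⊆p Y _) Y⊆I)) ⟩
      suc (r (Y - e))   ≤⟨ coloop-restrict Y⊆I e∈Y (coloops e (Y⊆I e∈Y)) ⟩
      r Y               ∎
      where open ≤-Reasoning

  ∃-basis : ∀ W → ∃ λ I → I ⊆ W × r I ≡ ∣ I ∣ × r I ≡ r W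
  ∃-basis W with ∃-minimal (λ I → I ⊆? W ×-dec r I ℕ.≟ r W) ∣_∣ (⊆-refl , refl)
  ... | I , (I⊆W , rI≡rW) , minimal = I , I⊆W , coloops⇒independent coloop , rI≡rW
    where
    coloop : ∀ e → e ∈ I → r (I - e) < r I
    coloop e e∈I with r (I - e) <? r I
    ... | yes drops  = drops
    ... | no  ¬drops = ⊥-elim (<⇒≱ (x∈p⇒∣p-x∣<∣p∣ e∈I) (minimal (I - e) (I-e⊆W , rI-e≡rW)))
      where
      I-e⊆W : I - e ⊆ W
      I-e⊆W = ⊆-trans (p─q⊆p I _) I⊆W
      rI-e≡rW : r (I - e) ≡ r W
      rI-e≡rW = trans (≤-antisym (r-mono (p─q⊆p I _)) (≮⇒≥ ¬drops)) rI≡rW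

-- Duality

module _ {n} (M : Matroid n) where

  open MatroidProperties M
  private
    r = rank M
    R = rank M ⊤

  dualRank+r⊤ : ∀ X → dualRank M X + R ≡ ∣ X ∣ + r (∁ X)
  dualRank+r⊤ X = m∸n+n≡m (begin
    R                 ≡⟨ cong r (∪-inverseˡ X) ⟨
    r (∁ X ∪ X)       ≤⟨ r[X∪Y]≤r[X]+∣Y∣ (∁ X) X ⟩
    r (∁ X) + ∣ X ∣   ≡⟨ +-comm (r (∁ X)) ∣ X ∣ ⟩
    ∣ X ∣ + r (∁ X)   ∎)
    where open ≤-Reasoning

  private
    r* = dualRank M

  dualRank-bound : ∀ X → r* X ≤ ∣ X ∣
  dualRank-bound X = +-cancelʳ-≤ R _ _ (begin
    r* X + R          ≡⟨ dualRank+r⊤ X ⟩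
    ∣ X ∣ + r (∁ X)   ≤⟨ +-monoʳ-≤ ∣ X ∣ (r-mono ⊆⊤) ⟩
    ∣ X ∣ + R         ∎)
    where open ≤-Reasoning

  dualRank-mono : ∀ X Y → X ⊆ Y → r* X ≤ r* Y
  dualRank-mono X Y X⊆Y = +-cancelʳ-≤ R _ _ (begin
    r* X + R                          ≡⟨ dualRank+r⊤ X ⟩
    ∣ X ∣ + r (∁ X)                   ≤⟨ +-monoʳ-≤ ∣ X ∣ (r-mono (∁p⊆∁q∪q─p X Y)) ⟩
    ∣ X ∣ + r (∁ Y ∪ (Y ─ X))         ≤⟨ +-monoʳ-≤ ∣ X ∣ (r[X∪Y]≤r[X]+∣Y∣ (∁ Y) (Y ─ X)) ⟩
    ∣ X ∣ + (r (∁ Y) + ∣ Y ─ X ∣)     ≡⟨ cong (∣ X ∣ +_) (+-comm (r (∁ Y)) _) ⟩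
    ∣ X ∣ + (∣ Y ─ X ∣ + r (∁ Y))     ≡⟨ +-assoc ∣ X ∣ _ _ ⟨
    ∣ X ∣ + ∣ Y ─ X ∣ + r (∁ Y)       ≡⟨ cong (_+ r (∁ Y)) (p⊆q⇒∣q∣≡∣p∣+∣q─p∣ X⊆Y) ⟨
    ∣ Y ∣ + r (∁ Y)                   ≡⟨ dualRank+r⊤ Y ⟨
    r* Y + R                          ∎)
    where open ≤-Reasoning

  dualRank-submod : ∀ X Y → r* (X ∪ Y) + r* (X ∩ Y) ≤ r* X + r* Y
  dualRank-submod X Y = +-cancelʳ-≤ (R + R) _ _ (begin
    (r* (X ∪ Y) + r* (X ∩ Y)) + (R + R)
      ≡⟨ interchange (r* (X ∪ Y)) (r* (X ∩ Y)) R R ⟩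
    (r* (X ∪ Y) + R) + (r* (X ∩ Y) + R)
      ≡⟨ cong₂ _+_ (dualRank+r⊤ (X ∪ Y)) (dualRank+r⊤ (X ∩ Y)) ⟩
    (∣ X ∪ Y ∣ + r (∁ (X ∪ Y))) + (∣ X ∩ Y ∣ + r (∁ (X ∩ Y)))
      ≡⟨ interchange ∣ X ∪ Y ∣ _ _ _ ⟩
    (∣ X ∪ Y ∣ + ∣ X ∩ Y ∣) + (r (∁ (X ∪ Y)) + r (∁ (X ∩ Y)))
      ≡⟨ cong₂ _+_ (∣p∪q∣+∣p∩q∣≡∣p∣+∣q∣ X Y) (cong₂ _+_ (cong r (deMorgan₂ X Y)) (cong r (deMorgan₁ X Y))) ⟩
    (∣ X ∣ + ∣ Y ∣) + (r (∁ X ∩ ∁ Y) + r (∁ X ∪ ∁ Y))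
      ≤⟨ +-monoʳ-≤ (∣ X ∣ + ∣ Y ∣) (≤-trans (≤-reflexive (+-comm (r (∁ X ∩ ∁ Y)) _)) (rank-submod M (∁ X) (∁ Y))) ⟩
    (∣ X ∣ + ∣ Y ∣) + (r (∁ X) + r (∁ Y))
      ≡⟨ interchange ∣ X ∣ _ _ _ ⟩
    (∣ X ∣ + r (∁ X)) + (∣ Y ∣ + r (∁ Y))
      ≡⟨ cong₂ _+_ (dualRank+r⊤ X) (dualRank+r⊤ Y) ⟨
    (r* X + R) + (r* Y + R)
      ≡⟨ interchange (r* X) R (r* Y) R ⟩
    (r* X + r* Y) + (R + R)   ∎)
    where
    open ≤-Reasoning
    open BooleanAlgebraProperties (∪-∩-booleanAlgebra n) using (deMorgan₁; deMorgan₂)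

  dual : Matroid n
  dual = record
    { rank        = r*
    ; rank-bound  = dualRank-bound
    ; rank-mono   = dualRank-mono
    ; rank-submod = dualRank-submod
    }

  -- Adding e to X raises the rank of M* exactly when removing e from ∁ X keeps the rank of M.
  r*[X∪⁅e⁆]+r[∁X]≡suc : ∀ {X e} → e ∉ X → r* (X ∪ ⁅ e ⁆) + r (∁ X) ≡ suc (r* X + r (∁ X - e))
  r*[X∪⁅e⁆]+r[∁X]≡suc {X} {e} e∉X = +-cancelʳ-≡ R _ _ (begin
    r* (X ∪ ⁅ e ⁆) + r (∁ X) + R         ≡⟨ swap (r* (X ∪ ⁅ e ⁆)) (r (∁ X)) R ⟩
    r* (X ∪ ⁅ e ⁆) + R + r (∁ X)         ≡⟨ cong (_+ r (∁ X)) r*[X∪⁅e⁆]+R ⟩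
    suc ∣ X ∣ + r (∁ X - e) + r (∁ X)    ≡⟨ cong suc (swap ∣ X ∣ (r (∁ X - e)) (r (∁ X))) ⟩
    suc (∣ X ∣ + r (∁ X) + r (∁ X - e))  ≡⟨ cong (λ w → suc (w + r (∁ X - e))) (dualRank+r⊤ X) ⟨
    suc (r* X + R + r (∁ X - e))         ≡⟨ cong suc (swap (r* X) R (r (∁ X - e))) ⟩
    suc (r* X + r (∁ X - e) + R)         ∎)
    where
    open ≡-Reasoning
    swap : ∀ a b c → a + b + c ≡ a + c + b
    swap = solve-∀
    r*[X∪⁅e⁆]+R : r* (X ∪ ⁅ e ⁆) + R ≡ suc ∣ X ∣ + r (∁ X - e)
    r*[X∪⁅e⁆]+R = trans (dualRank+r⊤ (X ∪ ⁅ e ⁆))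
                        (cong₂ _+_ (∣p∪⁅x⁆∣≡suc∣p∣ e e∉X) (cong r (∁-∪ X ⁅ e ⁆)))

  r*-grows⇒r[∁X-e]≡r[∁X] : ∀ {X e} → e ∉ X → r* X < r* (X ∪ ⁅ e ⁆) → r (∁ X - e) ≡ r (∁ X)
  r*-grows⇒r[∁X-e]≡r[∁X] {X} {e} e∉X grows =
    sym (+-cancelˡ-≡ (r* X) _ _ (suc-injective (trans (cong (_+ r (∁ X)) (sym r*≡suc)) (r*[X∪⁅e⁆]+r[∁X]≡suc e∉X))))
    where
    r*≡suc : r* (X ∪ ⁅ e ⁆) ≡ suc (r* X)
    r*≡suc = ≤-antisym (MatroidProperties.r[X∪⁅e⁆]≤suc-r[X] dual X e) grows

  r[∁X-e]≡r[∁X]⇒r*-grows : ∀ {X e} → e ∉ X → r (∁ X - e) ≡ r (∁ X) → r* X < r* (X ∪ ⁅ e ⁆)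
  r[∁X-e]≡r[∁X]⇒r*-grows {X} {e} e∉X same = ≤-reflexive (sym (+-cancelʳ-≡ (r (∁ X)) _ _
    (trans (r*[X∪⁅e⁆]+r[∁X]≡suc e∉X) (cong (λ w → suc (r* X + w)) same))))

  module _ {Z : Subset n} {e : Fin n} (e∈Z : e ∈ Z) where

    private
      e∉Z-e : e ∉ Z - e
      e∉Z-e e∈ = x∈p─q⇒x∉q e∈ (x∈⁅x⁆ e)
      Z-e∪⁅e⁆≡Z : (Z - e) ∪ ⁅ e ⁆ ≡ Z
      Z-e∪⁅e⁆≡Z = p-x∪⁅x⁆≡p e∈Z
      ∁[Z-e]≡∁Z∪⁅e⁆ : ∁ (Z - e) ≡ ∁ Z ∪ ⁅ e ⁆
      ∁[Z-e]≡∁Z∪⁅e⁆ = ∁-─ Z ⁅ e ⁆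
      ∁[Z-e]-e≡∁Z : ∁ (Z - e) - e ≡ ∁ Z
      ∁[Z-e]-e≡∁Z = trans (cong (_- e) ∁[Z-e]≡∁Z∪⁅e⁆) (p∪⁅x⁆-x≡p (x∈p⇒x∉∁p e∈Z))

    r*-drops⇒r[∁Z]≡r[∁Z∪⁅e⁆] : r* (Z - e) < r* Z → r (∁ Z) ≡ r (∁ Z ∪ ⁅ e ⁆)
    r*-drops⇒r[∁Z]≡r[∁Z∪⁅e⁆] drops =
      subst₂ (λ A B → r A ≡ r B) ∁[Z-e]-e≡∁Z ∁[Z-e]≡∁Z∪⁅e⁆
        (r*-grows⇒r[∁X-e]≡r[∁X] e∉Z-e (subst (λ W → r* (Z - e) < r* W) (sym Z-e∪⁅e⁆≡Z) drops))

    r[∁Z]≡r[∁Z∪⁅e⁆]⇒r*-drops : r (∁ Z) ≡ r (∁ Z ∪ ⁅ e ⁆) → r* (Z - e) < r* Z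
    r[∁Z]≡r[∁Z∪⁅e⁆]⇒r*-drops same =
      subst (λ W → r* (Z - e) < r* W) Z-e∪⁅e⁆≡Z
        (r[∁X-e]≡r[∁X]⇒r*-grows e∉Z-e (subst₂ (λ A B → r A ≡ r B) (sym ∁[Z-e]-e≡∁Z) (sym ∁[Z-e]≡∁Z∪⁅e⁆) same))

  isCyclicFlat-dual⇒∁ : ∀ {Z} → IsCyclicFlat dual Z → IsCyclicFlat M (∁ Z)
  isCyclicFlat-dual⇒∁ {Z} (flat* , cyclic*) = flat , cyclic
    where
    flat : IsFlat M (∁ Z)
    flat e e∉∁Z = ≤∧≢⇒< (r-mono (p⊆p∪q {p = ∁ Z} ⁅ e ⁆))
      (λ same → <⇒≢ (r[∁Z]≡r[∁Z∪⁅e⁆]⇒r*-drops e∈Z same) (cyclic* e e∈Z))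
      where
      e∈Z : e ∈ Z
      e∈Z = x∉∁p⇒x∈p e∉∁Z
    cyclic : IsCyclic M (∁ Z)
    cyclic e e∈∁Z = r*-grows⇒r[∁X-e]≡r[∁X] e∉Z (flat* e e∉Z)
      where
      e∉Z : e ∉ Z
      e∉Z = x∈∁p⇒x∉p e∈∁Z

  ∁-isCyclicFlat⇒dual : ∀ {Z} → IsCyclicFlat M (∁ Z) → IsCyclicFlat dual Z
  ∁-isCyclicFlat⇒dual {Z} (flat , cyclic) = flat* , cyclic*
    where
    flat* : IsFlat dual Z
    flat* e e∉Z = r[∁X-e]≡r[∁X]⇒r*-grows e∉Z (cyclic e (x∉p⇒x∈∁p e∉Z))
    cyclic* : IsCyclic dual Z
    cyclic* e e∈Z = ≤-antisym (rank-mono dual _ _ (p─q⊆p Z ⁅ e ⁆))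
      (≮⇒≥ (λ drops → <⇒≢ (flat e (x∈p⇒x∉∁p e∈Z)) (r*-drops⇒r[∁Z]≡r[∁Z∪⁅e⁆] e∈Z drops)))

-- Hall's theorem

neighbours : (Fin k → Subset n) → Subset n → Subset k
neighbours A U = subsetOf (λ i → any? λ x → (x ∈? U) ×-dec (x ∈? A i))

∈-neighbours⁺ : (A : Fin k → Subset n) {U : Subset n} {x : Fin n} {i : Fin k} →
                x ∈ U → x ∈ A i → i ∈ neighbours A U
∈-neighbours⁺ A {U} {x} x∈U x∈Ai = ∈-subsetOf⁺ (λ i → any? λ x → (x ∈? U) ×-dec (x ∈? A i)) (x , x∈U , x∈Ai)

∈-neighbours⁻ : (A : Fin k → Subset n) {U : Subset n} {i : Fin k} →
                i ∈ neighbours A U → ∃ λ x → x ∈ U × x ∈ A i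
∈-neighbours⁻ A {U} = ∈-subsetOf⁻ (λ i → any? λ x → (x ∈? U) ×-dec (x ∈? A i))

neighbours-mono : (A : Fin k → Subset n) {U V : Subset n} → U ⊆ V → neighbours A U ⊆ neighbours A V
neighbours-mono A U⊆V i∈ with ∈-neighbours⁻ A i∈
... | x , x∈U , x∈Ai = ∈-neighbours⁺ A (U⊆V x∈U) x∈Ai

HallCondition : (Fin k → Subset n) → Subset n → Set
HallCondition A X = ∀ U → U ⊆ X → ∣ U ∣ ≤ ∣ neighbours A U ∣

partialTransversal-⊆ : {A : Fin k → Subset n} {X Y : Subset n} →
                       Y ⊆ X → PartialTransversal A X → PartialTransversal A Y
partialTransversal-⊆ Y⊆X (f , maps , inj) =
  f , (λ x x∈Y → maps x (Y⊆X x∈Y)) , (λ x y x∈Y y∈Y → inj x y (Y⊆X x∈Y) (Y⊆X y∈Y))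

partialTransversal-shrink : {A A′ : Fin k → Subset n} {X : Subset n} →
                            (∀ i → A′ i ⊆ A i) → PartialTransversal A′ X → PartialTransversal A X
partialTransversal-shrink A′⊆A (f , maps , inj) = f , (λ x x∈X → A′⊆A (f x) (maps x x∈X)) , inj

partialTransversal⇒hallCondition : {A : Fin k → Subset n} {X : Subset n} →
                                   PartialTransversal A X → HallCondition A X
partialTransversal⇒hallCondition {A = A} pt U U⊆X with partialTransversal-⊆ {A = A} U⊆X pt
... | f , maps , inj = injection⇒∣p∣≤∣q∣ f U (neighbours A U) (λ x x∈U → ∈-neighbours⁺ A x∈U (maps x x∈U)) inj

remove : (Fin k → Subset n) → Fin k → Fin n → Fin k → Subset n
remove A i x j with j ≟ i
... | yes _ = A j - x
... | no  _ = A j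

remove-⊆ : (A : Fin k → Subset n) (i : Fin k) (x : Fin n) → ∀ j → remove A i x j ⊆ A j
remove-⊆ A i x j with j ≟ i
... | yes _ = p─q⊆p (A j) ⁅ x ⁆
... | no  _ = λ y∈ → y∈

∈-remove⁺ : (A : Fin k → Subset n) {i j : Fin k} {x y : Fin n} →
            y ∈ A j → (j ≡ i → y ≢ x) → y ∈ remove A i x j
∈-remove⁺ A {i} {j} y∈Aj y≢x with j ≟ i
... | yes j≡i = x∈p∧x≢y⇒x∈p-y y∈Aj (y≢x j≡i)
... | no  _   = y∈Aj

size : (Fin k → Subset n) → ℕ
size A = sum (λ i → ∣ A i ∣)

sum-mono : (f g : Fin k → ℕ) → (∀ j → f j ≤ g j) → sum f ≤ sum g
sum-mono {zero}  f g f≤g = z≤n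
sum-mono {suc k} f g f≤g = +-mono-≤ (f≤g zero) (sum-mono (f ∘ suc) (g ∘ suc) (f≤g ∘ suc))

sum-< : (f g : Fin k → ℕ) → (∀ j → f j ≤ g j) → ∀ i → f i < g i → sum f < sum g
sum-< f g f≤g zero    lt = +-mono-<-≤ lt (sum-mono (f ∘ suc) (g ∘ suc) (f≤g ∘ suc))
sum-< f g f≤g (suc i) lt = +-mono-≤-< (f≤g zero) (sum-< (f ∘ suc) (g ∘ suc) (f≤g ∘ suc) i lt)

size-remove : (A : Fin k → Subset n) {i : Fin k} {x : Fin n} → x ∈ A i → size (remove A i x) < size A
size-remove A {i} {x} x∈Ai =
  sum-< _ _ (λ j → p⊆q⇒∣p∣≤∣q∣ (remove-⊆ A i x j)) i (removed i refl)
  where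
  removed : ∀ j → j ≡ i → ∣ remove A i x j ∣ < ∣ A j ∣
  removed j j≡i with j ≟ i
  ... | yes refl = x∈p⇒∣p-x∣<∣p∣ x∈Ai
  ... | no  j≢i  = ⊥-elim (j≢i j≡i)

module _ (A : Fin k → Subset n) {i₁ i₂ : Fin k} {x : Fin n} {U₁ U₂ : Subset n} where

  private
    N₁ = neighbours (remove A i₁ x) U₁
    N₂ = neighbours (remove A i₂ x) U₂
    in-N₁ : ∀ {y j} → y ∈ U₁ → y ∈ A j → (j ≡ i₁ → y ≢ x) → j ∈ N₁
    in-N₁ y∈U₁ y∈Aj ok = ∈-neighbours⁺ (remove A i₁ x) y∈U₁ (∈-remove⁺ A y∈Aj ok)
    in-N₂ : ∀ {y j} → y ∈ U₂ → y ∈ A j → (j ≡ i₂ → y ≢ x) → j ∈ N₂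
    in-N₂ y∈U₂ y∈Aj ok = ∈-neighbours⁺ (remove A i₂ x) y∈U₂ (∈-remove⁺ A y∈Aj ok)

  neighbours-∪-remove : i₁ ≢ i₂ → x ∈ U₁ → x ∈ U₂ → neighbours A (U₁ ∪ U₂) ⊆ N₁ ∪ N₂
  neighbours-∪-remove i₁≢i₂ x∈U₁ x∈U₂ j∈ with ∈-neighbours⁻ A j∈
  ... | y , y∈U , y∈Aj = witness y∈U y∈Aj
    where
    witness : ∀ {y j} → y ∈ U₁ ∪ U₂ → y ∈ A j → j ∈ N₁ ∪ N₂
    witness {y} {j} y∈U y∈Aj with y ≟ x | j ≟ i₁ | x∈p∪q⁻ U₁ U₂ y∈U
    ... | yes refl | yes refl | _         = x∈p∪q⁺ (inj₂ (in-N₂ x∈U₂ y∈Aj (λ j≡i₂ _ → i₁≢i₂ j≡i₂)))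
    ... | yes refl | no j≢i₁  | _         = x∈p∪q⁺ (inj₁ (in-N₁ x∈U₁ y∈Aj (λ j≡i₁ _ → j≢i₁ j≡i₁)))
    ... | no  y≢x  | _        | inj₁ y∈U₁ = x∈p∪q⁺ (inj₁ (in-N₁ y∈U₁ y∈Aj (λ _ → y≢x)))
    ... | no  y≢x  | _        | inj₂ y∈U₂ = x∈p∪q⁺ (inj₂ (in-N₂ y∈U₂ y∈Aj (λ _ → y≢x)))

  neighbours-∩-remove : neighbours A ((U₁ ∩ U₂) - x) ⊆ N₁ ∩ N₂
  neighbours-∩-remove j∈ with ∈-neighbours⁻ A j∈
  ... | y , y∈W , y∈Aj with x∈p∩q⁻ U₁ U₂ (p─q⊆p _ ⁅ x ⁆ y∈W)
  ... | y∈U₁ , y∈U₂ = x∈p∩q⁺ (in-N₁ y∈U₁ y∈Aj (λ _ → y≢x) , in-N₂ y∈U₂ y∈Aj (λ _ → y≢x))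
    where
    y≢x : y ≢ x
    y≢x y≡x = x∈p─q⇒x∉q y∈W (subst (_∈ ⁅ x ⁆) (sym y≡x) (x∈⁅x⁆ x))

module HallTheorem {n k} (X : Subset n) (default : Fin n → Fin k) where

  Violation : (Fin k → Subset n) → Subset n → Set
  Violation A U = U ⊆ X × ∣ neighbours A U ∣ < ∣ U ∣

  hallCondition? : (A : Fin k → Subset n) → HallCondition A X ⊎ ∃ (Violation A)
  hallCondition? A with anySubset? (λ U → (U ⊆? X) ×-dec (∣ neighbours A U ∣ <? ∣ U ∣))
  ... | yes violation = inj₂ violation
  ... | no  ∄violation = inj₁ λ U U⊆X → ≮⇒≥ (λ lt → ∄violation (U , U⊆X , lt))

  Unambiguous : (Fin k → Subset n) → Set
  Unambiguous A = ∀ x → x ∈ X → ∀ i j → x ∈ A i → x ∈ A j → i ≡ j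

  Ambiguous : (Fin k → Subset n) → Set
  Ambiguous A = ∃ λ x → x ∈ X × ∃ λ i → ∃ λ j → x ∈ A i × x ∈ A j × i ≢ j

  ambiguous? : (A : Fin k → Subset n) → Ambiguous A ⊎ Unambiguous A
  ambiguous? A with any? (λ x → (x ∈? X) ×-dec any? (λ i → any? (λ j →
                                (x ∈? A i) ×-dec (x ∈? A j) ×-dec ¬? (i ≟ j))))
  ... | yes ambiguous = inj₁ ambiguous
  ... | no  ¬ambiguous = inj₂ λ x x∈X i j x∈Ai x∈Aj →
          decidable-stable (i ≟ j) (λ i≢j → ¬ambiguous (x , x∈X , i , j , x∈Ai , x∈Aj , i≢j))

  -- With every element of X in at most one set, Hall's condition on singletons and pairs
  -- says that this set exists and that distinct elements get distinct sets.
  unambiguous⇒partialTransversal : (A : Fin k → Subset n) →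
    Unambiguous A → HallCondition A X → PartialTransversal A X
  unambiguous⇒partialTransversal A unique hall = f , maps , injective
    where
    f : Fin n → Fin k
    f x with any? (λ i → x ∈? A i)
    ... | yes (i , _) = i
    ... | no  _       = default x
    covered : ∀ x → x ∈ X → ∃ λ i → x ∈ A i
    covered x x∈X with 0<∣p∣⇒nonempty (≤-trans (≤-reflexive (sym (∣⁅x⁆∣≡1 x))) (hall ⁅ x ⁆ ⁅x⁆⊆X))
      where
      ⁅x⁆⊆X : ⁅ x ⁆ ⊆ X
      ⁅x⁆⊆X y∈ rewrite x∈⁅y⁆⇒x≡y x y∈ = x∈X
    ... | i , i∈ with ∈-neighbours⁻ A i∈
    ... | y , y∈⁅x⁆ , y∈Ai rewrite x∈⁅y⁆⇒x≡y x y∈⁅x⁆ = i , y∈Ai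
    maps : ∀ x → x ∈ X → x ∈ A (f x)
    maps x x∈X with any? (λ i → x ∈? A i)
    ... | yes (i , x∈Ai) = x∈Ai
    ... | no  ∄i         = ⊥-elim (∄i (covered x x∈X))
    injective : InjectiveOn f X
    injective x y x∈X y∈X fx≡fy with x ≟ y
    ... | yes x≡y = x≡y
    ... | no  x≢y = ⊥-elim (<⇒≱ (s≤s (s≤s z≤n)) (begin
      2                                    ≡⟨ cong suc (∣⁅x⁆∣≡1 x) ⟨
      suc ∣ ⁅ x ⁆ ∣                        ≡⟨ ∣p∪⁅x⁆∣≡suc∣p∣ y (x≢y⇒x∉⁅y⁆ (x≢y ∘ sym)) ⟨
      ∣ ⁅ x ⁆ ∪ ⁅ y ⁆ ∣                   ≤⟨ hall (⁅ x ⁆ ∪ ⁅ y ⁆) pair⊆X ⟩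
      ∣ neighbours A (⁅ x ⁆ ∪ ⁅ y ⁆) ∣    ≤⟨ p⊆q⇒∣p∣≤∣q∣ only-f[x] ⟩
      ∣ ⁅ f x ⁆ ∣                          ≡⟨ ∣⁅x⁆∣≡1 (f x) ⟩
      1                                    ∎))
      where
      open ≤-Reasoning
      pair⊆X : ⁅ x ⁆ ∪ ⁅ y ⁆ ⊆ X
      pair⊆X z∈ with x∈p∪q⁻ ⁅ x ⁆ ⁅ y ⁆ z∈
      ... | inj₁ z∈⁅x⁆ rewrite x∈⁅y⁆⇒x≡y x z∈⁅x⁆ = x∈X
      ... | inj₂ z∈⁅y⁆ rewrite x∈⁅y⁆⇒x≡y y z∈⁅y⁆ = y∈X
      only-f[x] : neighbours A (⁅ x ⁆ ∪ ⁅ y ⁆) ⊆ ⁅ f x ⁆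
      only-f[x] {j} j∈ with ∈-neighbours⁻ A j∈
      ... | z , z∈ , z∈Aj with x∈p∪q⁻ ⁅ x ⁆ ⁅ y ⁆ z∈
      ... | inj₁ z∈⁅x⁆ rewrite x∈⁅y⁆⇒x≡y x z∈⁅x⁆ =
              subst (_∈ ⁅ f x ⁆) (unique x x∈X (f x) j (maps x x∈X) z∈Aj) (x∈⁅x⁆ (f x))
      ... | inj₂ z∈⁅y⁆ rewrite x∈⁅y⁆⇒x≡y y z∈⁅y⁆ =
              subst (_∈ ⁅ f x ⁆) (trans fx≡fy (unique y y∈X (f y) j (maps y y∈X) z∈Aj)) (x∈⁅x⁆ (f x))

  neighbours-remove : ∀ A {i : Fin k} {x : Fin n} {U : Subset n} →
                      x ∉ U → neighbours A U ⊆ neighbours (remove A i x) U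
  neighbours-remove A {i} {x} {U} x∉U j∈ with ∈-neighbours⁻ A j∈
  ... | y , y∈U , y∈Aj =
    ∈-neighbours⁺ (remove A i x) y∈U (∈-remove⁺ A y∈Aj (λ _ y≡x → x∉U (subst (_∈ U) y≡x y∈U)))

  violation-contains : ∀ {A i x U} → HallCondition A X → Violation (remove A i x) U → x ∈ U
  violation-contains {A} {i} {x} {U} hall (U⊆X , lt) with x ∈? U
  ... | yes x∈U = x∈U
  ... | no  x∉U = ⊥-elim (<⇒≱ lt (≤-trans (hall U U⊆X) (p⊆q⇒∣p∣≤∣q∣ (neighbours-remove A x∉U))))

  -- Rado's argument: U₁ ∪ U₂ and (U₁ ∩ U₂) - x have together at most ∣ N₁ ∣ + ∣ N₂ ∣ neighbours
  -- in A, one less than Hall's condition for A demands.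
  rado : ∀ {A i₁ i₂ x U₁ U₂} → HallCondition A X → i₁ ≢ i₂ →
         Violation (remove A i₁ x) U₁ → ¬ Violation (remove A i₂ x) U₂
  rado {A} {i₁} {i₂} {x} {U₁} {U₂} hall i₁≢i₂ v₁@(U₁⊆X , lt₁) v₂@(U₂⊆X , lt₂) =
    1+n≰n (begin
      suc (suc (∣ N₁ ∣ + ∣ N₂ ∣))                          ≡⟨ cong suc (+-suc ∣ N₁ ∣ ∣ N₂ ∣) ⟨
      suc ∣ N₁ ∣ + suc ∣ N₂ ∣                              ≤⟨ +-mono-≤ lt₁ lt₂ ⟩
      ∣ U₁ ∣ + ∣ U₂ ∣                                      ≡⟨ ∣p∪q∣+∣p∩q∣≡∣p∣+∣q∣ U₁ U₂ ⟨
      ∣ U₁ ∪ U₂ ∣ + ∣ U₁ ∩ U₂ ∣                            ≡⟨ cong (∣ U₁ ∪ U₂ ∣ +_) (suc∣p-x∣≡∣p∣ x∈U₁∩U₂) ⟨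
      ∣ U₁ ∪ U₂ ∣ + suc ∣ W ∣                              ≡⟨ +-suc _ _ ⟩
      suc (∣ U₁ ∪ U₂ ∣ + ∣ W ∣)                            ≤⟨ s≤s (+-mono-≤ (hall _ U₁∪U₂⊆X) (hall W W⊆X)) ⟩
      suc (∣ neighbours A (U₁ ∪ U₂) ∣ + ∣ neighbours A W ∣) ≤⟨ s≤s (+-mono-≤ (p⊆q⇒∣p∣≤∣q∣ ∪⊆) (p⊆q⇒∣p∣≤∣q∣ (neighbours-∩-remove A))) ⟩
      suc (∣ N₁ ∪ N₂ ∣ + ∣ N₁ ∩ N₂ ∣)                      ≡⟨ cong suc (∣p∪q∣+∣p∩q∣≡∣p∣+∣q∣ N₁ N₂) ⟩
      suc (∣ N₁ ∣ + ∣ N₂ ∣)                                ∎)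
    where
    open ≤-Reasoning
    N₁ = neighbours (remove A i₁ x) U₁
    N₂ = neighbours (remove A i₂ x) U₂
    W = (U₁ ∩ U₂) - x
    x∈U₁ = violation-contains hall v₁
    x∈U₂ = violation-contains hall v₂
    x∈U₁∩U₂ : x ∈ U₁ ∩ U₂
    x∈U₁∩U₂ = x∈p∩q⁺ (x∈U₁ , x∈U₂)
    ∪⊆ : neighbours A (U₁ ∪ U₂) ⊆ N₁ ∪ N₂
    ∪⊆ = neighbours-∪-remove A i₁≢i₂ x∈U₁ x∈U₂
    U₁∪U₂⊆X : U₁ ∪ U₂ ⊆ X
    U₁∪U₂⊆X y∈ with x∈p∪q⁻ U₁ U₂ y∈
    ... | inj₁ y∈U₁ = U₁⊆X y∈U₁
    ... | inj₂ y∈U₂ = U₂⊆X y∈U₂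
    W⊆X : W ⊆ X
    W⊆X = U₁⊆X ∘ p∩q⊆p U₁ U₂ ∘ p─q⊆p _ ⁅ x ⁆

  removable : ∀ {A} → HallCondition A X → Ambiguous A →
              ∃ λ i → ∃ λ x → x ∈ A i × HallCondition (remove A i x) X
  removable {A} hall (x , _ , i₁ , i₂ , x∈A₁ , x∈A₂ , i₁≢i₂)
    with hallCondition? (remove A i₁ x) | hallCondition? (remove A i₂ x)
  ... | inj₁ hall₁    | _             = i₁ , x , x∈A₁ , hall₁
  ... | inj₂ _        | inj₁ hall₂    = i₂ , x , x∈A₂ , hall₂
  ... | inj₂ (_ , v₁) | inj₂ (_ , v₂) = ⊥-elim (rado hall i₁≢i₂ v₁ v₂)

  partialTransversal-bySize : ∀ m A → size A < m → HallCondition A X → PartialTransversal A X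
  partialTransversal-bySize (suc m) A size<m hall with ambiguous? A
  ... | inj₂ unambiguous = unambiguous⇒partialTransversal A unambiguous hall
  ... | inj₁ ambiguous with removable hall ambiguous
  ... | i , x , x∈Ai , hall′ = partialTransversal-shrink (remove-⊆ A i x)
          (partialTransversal-bySize m (remove A i x) (<-≤-trans (size-remove A x∈Ai) (≤-pred size<m)) hall′)

  hall : ∀ A → HallCondition A X → PartialTransversal A X
  hall A = partialTransversal-bySize (suc (size A)) A ≤-refl

module Padding {n k} (A : Fin k → Subset n) (d : ℕ) where

  padded : Fin (k + d) → Subset n
  padded j = [ A , (λ _ → ⊤) ]′ (splitAt k j)

  padded-↑ˡ : ∀ i → padded (i ↑ˡ d) ≡ A i
  padded-↑ˡ i = cong [ A , (λ _ → ⊤) ]′ (splitAt-↑ˡ k i d)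

  padded-↑ʳ : ∀ j → padded (k ↑ʳ j) ≡ ⊤
  padded-↑ʳ j = cong [ A , (λ _ → ⊤) ]′ (splitAt-↑ʳ k d j)

  neighbours-padded : ∀ {U} → Nonempty U → ∣ neighbours A U ∣ + d ≤ ∣ neighbours padded U ∣
  neighbours-padded {U} (x , x∈U) = begin
    ∣ neighbours A U ∣ + d             ≡⟨ cong (∣ neighbours A U ∣ +_) (∣⊤∣≡n d) ⟨
    ∣ neighbours A U ∣ + ∣ ⊤ {d} ∣     ≡⟨ ∣p++q∣≡∣p∣+∣q∣ (neighbours A U) ⊤ ⟨
    ∣ neighbours A U ++ ⊤ {d} ∣        ≤⟨ p⊆q⇒∣p∣≤∣q∣ ⊆padded ⟩
    ∣ neighbours padded U ∣            ∎
    where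
    open ≤-Reasoning
    ⊆padded : neighbours A U ++ ⊤ ⊆ neighbours padded U
    ⊆padded j∈ with ∈-++⁻ (neighbours A U) j∈
    ... | inj₁ (i , i∈ , refl) with ∈-neighbours⁻ A i∈
    ...   | y , y∈U , y∈Ai =
            ∈-neighbours⁺ padded y∈U (subst (y ∈_) (sym (padded-↑ˡ i)) y∈Ai)
    ⊆padded j∈ | inj₂ (j , _ , refl) =
            ∈-neighbours⁺ padded x∈U (subst (x ∈_) (sym (padded-↑ʳ j)) ∈⊤)

  padded-hallCondition : ∀ {W m} → suc m + d ≡ ∣ W ∣ →
                         (∀ U → U ⊆ W → m < ∣ W ─ U ∣ + ∣ neighbours A U ∣) → HallCondition padded W
  padded-hallCondition {W} {m} ∣W∣≡ too-big U U⊆W with nonempty? U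
  ... | no  U-empty    = ≤-trans (≤-reflexive (trans (cong ∣_∣ (Empty-unique U-empty)) (∣⊥∣≡0 n))) z≤n
  ... | yes U-nonempty = ≤-trans (+-cancelˡ-≤ ∣ W ─ U ∣ _ _ (begin
      ∣ W ─ U ∣ + ∣ U ∣                      ≡⟨ +-comm ∣ W ─ U ∣ ∣ U ∣ ⟩
      ∣ U ∣ + ∣ W ─ U ∣                      ≡⟨ p⊆q⇒∣q∣≡∣p∣+∣q─p∣ U⊆W ⟨
      ∣ W ∣                                  ≡⟨ ∣W∣≡ ⟨
      suc m + d                              ≤⟨ +-monoˡ-≤ d (too-big U U⊆W) ⟩
      ∣ W ─ U ∣ + ∣ neighbours A U ∣ + d     ≡⟨ +-assoc ∣ W ─ U ∣ _ d ⟩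
      ∣ W ─ U ∣ + (∣ neighbours A U ∣ + d)   ∎)) (neighbours-padded U-nonempty)
    where open ≤-Reasoning

  module WithPartialTransversal {W : Subset n} (default : Fin n → Fin k) (pt : PartialTransversal padded W) where

    private
      f′ = proj₁ pt

    OnLeft : Fin n → Set
    OnLeft x = ∃ λ i → splitAt k (f′ x) ≡ inj₁ i

    onLeft? : Decidable OnLeft
    onLeft? x with splitAt k (f′ x)
    ... | inj₁ i = yes (i , refl)
    ... | inj₂ _ = no λ ()

    left : Subset n
    left = subsetOf (λ x → (x ∈? W) ×-dec onLeft? x)

    left⊆W : left ⊆ W
    left⊆W = proj₁ ∘ ∈-subsetOf⁻ (λ x → (x ∈? W) ×-dec onLeft? x)

    left-partialTransversal : PartialTransversal A left
    left-partialTransversal = f , maps , injective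
      where
      f : Fin n → Fin k
      f x = [ (λ i → i) , (λ _ → default x) ]′ (splitAt k (f′ x))
      f-left : ∀ {x} → x ∈ left → f′ x ≡ f x ↑ˡ d
      f-left x∈ with ∈-subsetOf⁻ (λ x → (x ∈? W) ×-dec onLeft? x) x∈
      ... | _ , i , eq rewrite eq = sym (splitAt⁻¹-↑ˡ eq)
      maps : ∀ x → x ∈ left → x ∈ A (f x)
      maps x x∈ = subst (x ∈_) (trans (cong padded (f-left x∈)) (padded-↑ˡ (f x)))
                        (proj₁ (proj₂ pt) x (left⊆W x∈))
      injective : InjectiveOn f left
      injective x y x∈ y∈ fx≡fy = proj₂ (proj₂ pt) x y (left⊆W x∈) (left⊆W y∈)
        (trans (f-left x∈) (trans (cong (_↑ˡ d) fx≡fy) (sym (f-left y∈))))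

    ∣W─left∣≤d : ∣ W ─ left ∣ ≤ d
    ∣W─left∣≤d = begin
      ∣ W ─ left ∣          ≤⟨ injection⇒∣p∣≤∣q∣ f′ (W ─ left) (⊥ {k} ++ ⊤ {d}) maps injective ⟩
      ∣ ⊥ {k} ++ ⊤ {d} ∣    ≡⟨ ∣p++q∣≡∣p∣+∣q∣ (⊥ {k}) ⊤ ⟩
      ∣ ⊥ {k} ∣ + ∣ ⊤ {d} ∣ ≡⟨ cong₂ _+_ (∣⊥∣≡0 k) (∣⊤∣≡n d) ⟩
      d                     ∎
      where
      open ≤-Reasoning
      maps : ∀ x → x ∈ W ─ left → f′ x ∈ ⊥ {k} ++ ⊤ {d}
      maps x x∈ with splitAt k (f′ x) in eq
      ... | inj₂ j = subst (_∈ ⊥ {k} ++ ⊤ {d}) (splitAt⁻¹-↑ʳ eq) (x∈q⇒m↑ʳx∈p++q (⊥ {k}) ∈⊤)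
      ... | inj₁ i = ⊥-elim (x∈p─q⇒x∉q x∈
                       (∈-subsetOf⁺ (λ x → (x ∈? W) ×-dec onLeft? x) (p─q⊆p W left x∈ , i , eq)))
      injective : InjectiveOn f′ (W ─ left)
      injective x y x∈ y∈ = proj₂ (proj₂ pt) x y (p─q⊆p W left x∈) (p─q⊆p W left y∈)

-- Otherwise Hall's theorem applies after adding ∣ W ∣ ∸ suc m copies of the ground set to the
-- system, and the part of W matched into A is too large.
defect-hall : (A : Fin k → Subset n) → (Fin n → Fin k) → ∀ W m →
              (∀ I → I ⊆ W → PartialTransversal A I → ∣ I ∣ ≤ m) →
              ∃ λ U → U ⊆ W × ∣ W ─ U ∣ + ∣ neighbours A U ∣ ≤ m
defect-hall {k} {n} A default W m bounded
  with anySubset? (λ U → (U ⊆? W) ×-dec (∣ W ─ U ∣ + ∣ neighbours A U ∣ ≤? m))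
... | yes found = found
... | no  ∄U    = ⊥-elim (1+n≰n (begin
  suc ∣ W ∣                  ≡⟨ cong suc (p⊆q⇒∣q∣≡∣p∣+∣q─p∣ left⊆W) ⟩
  suc (∣ left ∣ + ∣ W ─ left ∣) ≤⟨ s≤s (+-mono-≤ (bounded left left⊆W left-partialTransversal) ∣W─left∣≤d) ⟩
  suc m + d                  ≡⟨ m+[n∸m]≡n m<∣W∣ ⟩
  ∣ W ∣                      ∎))
  where
  open ≤-Reasoning
  too-big : ∀ U → U ⊆ W → m < ∣ W ─ U ∣ + ∣ neighbours A U ∣
  too-big U U⊆W = ≰⇒> (λ le → ∄U (U , U⊆W , le))
  m<∣W∣ : m < ∣ W ∣
  m<∣W∣ = begin-strict
    m                                    <⟨ too-big ⊥ (λ x∈⊥ → ⊥-elim (∉⊥ x∈⊥)) ⟩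
    ∣ W ─ ⊥ ∣ + ∣ neighbours A ⊥ ∣       ≤⟨ +-mono-≤ (≤-reflexive (cong ∣_∣ (p─⊥≡p W))) no-neighbours ⟩
    ∣ W ∣ + 0                            ≡⟨ +-identityʳ _ ⟩
    ∣ W ∣                                ∎
    where
    no-neighbours : ∣ neighbours A ⊥ ∣ ≤ 0
    no-neighbours = ≤-trans (p⊆q⇒∣p∣≤∣q∣ {q = ⊥} (λ i∈ → ⊥-elim (∉⊥ (proj₁ (proj₂ (∈-neighbours⁻ A i∈))))))
                            (≤-reflexive (∣⊥∣≡0 k))
  d = ∣ W ∣ ∸ suc m
  open Padding A d
  pt : PartialTransversal padded W
  pt = HallTheorem.hall W (λ x → default x ↑ˡ d) padded
         (padded-hallCondition (m+[n∸m]≡n m<∣W∣) too-big)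
  open WithPartialTransversal default pt

-- Transversal matroids and their expansions

Presents : (Subset n → ℕ) → (Fin k → Subset n) → Set
Presents r A = ∀ X → (r X ≡ ∣ X ∣ → PartialTransversal A X) × (PartialTransversal A X → r X ≡ ∣ X ∣)

module TransversalProperties {n k} (M : Matroid n) {A : Fin k → Subset n} (presents : Presents (rank M) A) where

  open MatroidProperties M

  -- Hall's theorem needs some map Fin n → Fin k; a partial transversal of the independent set ⊥ is one.
  default : Fin n → Fin k
  default = proj₁ (proj₁ (presents ⊥) (trans r⊥≡0 (sym (∣⊥∣≡0 n))))
    where
    r⊥≡0 : rank M ⊥ ≡ 0
    r⊥≡0 = n≤0⇒n≡0 (≤-trans (rank-bound M ⊥) (≤-reflexive (∣⊥∣≡0 n)))

  r≤∣neighbours∣ : ∀ W → rank M W ≤ ∣ neighbours A W ∣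
  r≤∣neighbours∣ W with ∃-basis W
  ... | I , I⊆W , independent , rI≡rW = begin
    rank M W                ≡⟨ trans (sym rI≡rW) independent ⟩
    ∣ I ∣                   ≤⟨ partialTransversal⇒hallCondition (proj₁ (presents I) independent) I ⊆-refl ⟩
    ∣ neighbours A I ∣      ≤⟨ p⊆q⇒∣p∣≤∣q∣ (neighbours-mono A I⊆W) ⟩
    ∣ neighbours A W ∣      ∎
    where open ≤-Reasoning

  ∃-deficientSubset : ∀ W → ∃ λ U → U ⊆ W × ∣ W ─ U ∣ + ∣ neighbours A U ∣ ≤ rank M W
  ∃-deficientSubset W = defect-hall A default W (rank M W) λ I I⊆W pt →
    ≤-trans (≤-reflexive (sym (proj₂ (presents I) pt))) (r-mono I⊆W)

module _ (t : ℕ) where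

  ∈-S⁺ : (X : Subset n) {j : Fin (n * t)} → quotient t j ∈ X → j ∈ S[ t ] X
  ∈-S⁺ X {j} q∈X = lookup⇒[]= j _ (trans (lookup∘tabulate _ j) ([]=⇒lookup q∈X))

  ∈-S⁻ : (X : Subset n) {j : Fin (n * t)} → j ∈ S[ t ] X → quotient t j ∈ X
  ∈-S⁻ X {j} j∈ = lookup⇒[]= _ X (trans (sym (lookup∘tabulate _ j)) ([]=⇒lookup j∈))

  S-mono : {X Y : Subset n} → X ⊆ Y → S[ t ] X ⊆ S[ t ] Y
  S-mono {X = X} {Y} X⊆Y = ∈-S⁺ Y ∘ X⊆Y ∘ ∈-S⁻ X

  S-─ : (X Y : Subset n) → S[ t ] (X ─ Y) ≡ S[ t ] X ─ S[ t ] Y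
  S-─ X Y = ⊆-antisym
    (λ j∈ → x∈p∧x∉q⇒x∈p─q (∈-S⁺ X (p─q⊆p X Y (∈-S⁻ (X ─ Y) j∈))) (x∈p─q⇒x∉q (∈-S⁻ (X ─ Y) j∈) ∘ ∈-S⁻ Y))
    (λ j∈ → ∈-S⁺ (X ─ Y) (x∈p∧x∉q⇒x∈p─q (∈-S⁻ X (p─q⊆p _ _ j∈)) (x∈p─q⇒x∉q j∈ ∘ ∈-S⁺ Y)))

  S-∁ : (X : Subset n) → S[ t ] (∁ X) ≡ ∁ (S[ t ] X)
  S-∁ X = ⊆-antisym
    (λ j∈ → x∉p⇒x∈∁p (x∈∁p⇒x∉p (∈-S⁻ (∁ X) j∈) ∘ ∈-S⁻ X))
    (λ j∈ → ∈-S⁺ (∁ X) (x∉p⇒x∈∁p (x∈∁p⇒x∉p j∈ ∘ ∈-S⁺ X)))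

  S-⊤ : S[ t ] (⊤ {n}) ≡ ⊤
  S-⊤ {n} = ⊆-antisym (λ _ → ∈⊤) (λ _ → ∈-S⁺ (⊤ {n}) ∈⊤)

  quotient-↑ˡ : ∀ {m} (i : Fin t) → quotient {suc m} t (i ↑ˡ (m * t)) ≡ zero
  quotient-↑ˡ {m} i rewrite splitAt-↑ˡ t i (m * t) = refl

  quotient-↑ʳ : ∀ {m} (j : Fin (m * t)) → quotient {suc m} t (t ↑ʳ j) ≡ suc (quotient t j)
  quotient-↑ʳ {m} j rewrite splitAt-↑ʳ t (m * t) j = refl

  S-∷ : ∀ b (X : Subset n) → S[ t ] (b ∷ X) ≡ replicate t b ++ S[ t ] X
  S-∷ b X = trans (tabulate-++ t _) (cong₂ _++_
    (trans (tabulate-cong (cong (lookup (b ∷ X)) ∘ quotient-↑ˡ)) (tabulate-const t b))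
    (tabulate-cong (cong (lookup (b ∷ X)) ∘ quotient-↑ʳ)))

  ∣S∣ : (X : Subset n) → ∣ S[ t ] X ∣ ≡ t * ∣ X ∣
  ∣S∣ []            = sym (*-zeroʳ t)
  ∣S∣ (inside  ∷ X) = begin
    ∣ S[ t ] (inside ∷ X) ∣           ≡⟨ cong ∣_∣ (S-∷ inside X) ⟩
    ∣ ⊤ {t} ++ S[ t ] X ∣             ≡⟨ ∣p++q∣≡∣p∣+∣q∣ (⊤ {t}) (S[ t ] X) ⟩
    ∣ ⊤ {t} ∣ + ∣ S[ t ] X ∣          ≡⟨ cong₂ _+_ (∣⊤∣≡n t) (∣S∣ X) ⟩
    t + t * ∣ X ∣                     ≡⟨ *-suc t ∣ X ∣ ⟨
    t * ∣ inside ∷ X ∣                ∎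
    where open ≡-Reasoning
  ∣S∣ (outside ∷ X) = begin
    ∣ S[ t ] (outside ∷ X) ∣          ≡⟨ cong ∣_∣ (S-∷ outside X) ⟩
    ∣ ⊥ {t} ++ S[ t ] X ∣             ≡⟨ ∣p++q∣≡∣p∣+∣q∣ (⊥ {t}) (S[ t ] X) ⟩
    ∣ ⊥ {t} ∣ + ∣ S[ t ] X ∣          ≡⟨ cong₂ _+_ (∣⊥∣≡0 t) (∣S∣ X) ⟩
    t * ∣ X ∣                         ∎
    where open ≡-Reasoning

module _ {n : ℕ} (t : ℕ) where

  blocks : Subset (n * t) → Subset n
  blocks U = subsetOf (λ e → any? λ j → (j ∈? U) ×-dec (quotient t j ≟ e))

  ∈-blocks⁺ : (U : Subset (n * t)) {j : Fin (n * t)} → j ∈ U → quotient t j ∈ blocks U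
  ∈-blocks⁺ U {j} j∈U = ∈-subsetOf⁺ (λ e → any? λ j → (j ∈? U) ×-dec (quotient t j ≟ e)) (j , j∈U , refl)

  ∈-blocks⁻ : (U : Subset (n * t)) {e : Fin n} → e ∈ blocks U → ∃ λ j → j ∈ U × quotient t j ≡ e
  ∈-blocks⁻ U = ∈-subsetOf⁻ (λ e → any? λ j → (j ∈? U) ×-dec (quotient t j ≟ e))

  blocks-⊆ : {U : Subset (n * t)} {W : Subset n} → U ⊆ S[ t ] W → blocks U ⊆ W
  blocks-⊆ {U = U} {W} U⊆SW e∈ with ∈-blocks⁻ U e∈
  ... | j , j∈U , refl = ∈-S⁻ t W (U⊆SW j∈U)

  expand : (Fin k → Subset n) → Fin (k * t) → Subset (n * t)
  expand A i = S[ t ] (A (quotient t i))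

  neighbours-expand : (A : Fin k → Subset n) (U : Subset (n * t)) →
                      neighbours (expand A) U ≡ S[ t ] (neighbours A (blocks U))
  neighbours-expand A U = ⊆-antisym ⊆S ⊇S
    where
    ⊆S : neighbours (expand A) U ⊆ S[ t ] (neighbours A (blocks U))
    ⊆S {i} i∈ with ∈-neighbours⁻ (expand A) i∈
    ... | j , j∈U , j∈Ai =
      ∈-S⁺ t (neighbours A (blocks U)) (∈-neighbours⁺ A (∈-blocks⁺ U j∈U) (∈-S⁻ t (A (quotient t i)) j∈Ai))
    ⊇S : S[ t ] (neighbours A (blocks U)) ⊆ neighbours (expand A) U
    ⊇S {i} i∈ with ∈-neighbours⁻ A (∈-S⁻ t (neighbours A (blocks U)) i∈)
    ... | e , e∈blocks , e∈Ai with ∈-blocks⁻ U e∈blocks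
    ...   | j , j∈U , refl = ∈-neighbours⁺ (expand A) j∈U (∈-S⁺ t (A (quotient t i)) e∈Ai)

module Expansion {n} (t : ℕ) (M : Matroid n) (N : Matroid (n * t)) (exp : IsExpansion t M N) where

  private
    module PM = MatroidProperties M
    module PN = MatroidProperties N
    rM = rank M
    rN = rank N

    cyclicFlat⇒S : ∀ Z → IsCyclicFlat N Z → ∃ λ A → IsCyclicFlat M A × Z ≡ S[ t ] A
    cyclicFlat⇒S = proj₁ exp

    S-cyclicFlat : ∀ A → IsCyclicFlat M A → IsCyclicFlat N (S[ t ] A)
    S-cyclicFlat = proj₁ (proj₂ exp)

    rank-S-cyclicFlat : ∀ A → IsCyclicFlat M A → rN (S[ t ] A) ≡ t * rM A
    rank-S-cyclicFlat = proj₂ (proj₂ exp)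

  S-witness : ∀ X {A} → IsCyclicFlat M A → rN (S[ t ] A) + ∣ S[ t ] X ─ S[ t ] A ∣ ≡ t * (rM A + ∣ X ─ A ∣)
  S-witness X {A} cf = begin
    rN (S[ t ] A) + ∣ S[ t ] X ─ S[ t ] A ∣   ≡⟨ cong₂ _+_ (rank-S-cyclicFlat A cf) (cong ∣_∣ (sym (S-─ t X A))) ⟩
    t * rM A + ∣ S[ t ] (X ─ A) ∣            ≡⟨ cong (t * rM A +_) (∣S∣ t (X ─ A)) ⟩
    t * rM A + t * ∣ X ─ A ∣                 ≡⟨ *-distribˡ-+ t _ _ ⟨
    t * (rM A + ∣ X ─ A ∣)                   ∎
    where open ≡-Reasoning

  rank-S : ∀ X → rN (S[ t ] X) ≡ t * rM X
  rank-S X = ≤-antisym upper lower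
    where
    open ≤-Reasoning
    upper : rN (S[ t ] X) ≤ t * rM X
    upper with PM.∃-cyclicFlat-witness X
    ... | A , cf , w = begin
      rN (S[ t ] X)                             ≤⟨ PN.r[X]≤r[Z]+∣X─Z∣ (S[ t ] X) (S[ t ] A) ⟩
      rN (S[ t ] A) + ∣ S[ t ] X ─ S[ t ] A ∣   ≡⟨ S-witness X cf ⟩
      t * (rM A + ∣ X ─ A ∣)                    ≤⟨ *-monoʳ-≤ t w ⟩
      t * rM X                                  ∎
    lower : t * rM X ≤ rN (S[ t ] X)
    lower with PN.∃-cyclicFlat-witness (S[ t ] X)
    ... | Z , cfZ , w with cyclicFlat⇒S Z cfZ
    ... | A , cf , refl = begin
      t * rM X                                  ≤⟨ *-monoʳ-≤ t (PM.r[X]≤r[Z]+∣X─Z∣ X A) ⟩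
      t * (rM A + ∣ X ─ A ∣)                    ≡⟨ S-witness X cf ⟨
      rN (S[ t ] A) + ∣ S[ t ] X ─ S[ t ] A ∣   ≤⟨ w ⟩
      rN (S[ t ] X)                             ∎

  dualRank-S : ∀ X → dualRank N (S[ t ] X) ≡ t * dualRank M X
  dualRank-S X = +-cancelʳ-≡ (rN ⊤) _ _ (begin
    dualRank N (S[ t ] X) + rN ⊤          ≡⟨ dualRank+r⊤ N (S[ t ] X) ⟩
    ∣ S[ t ] X ∣ + rN (∁ (S[ t ] X))      ≡⟨ cong₂ _+_ (∣S∣ t X) (trans (cong rN (sym (S-∁ t X))) (rank-S (∁ X))) ⟩
    t * ∣ X ∣ + t * rM (∁ X)              ≡⟨ *-distribˡ-+ t _ _ ⟨
    t * (∣ X ∣ + rM (∁ X))                ≡⟨ cong (t *_) (dualRank+r⊤ M X) ⟨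
    t * (dualRank M X + rM ⊤)             ≡⟨ *-distribˡ-+ t _ _ ⟩
    t * dualRank M X + t * rM ⊤           ≡⟨ cong (t * dualRank M X +_) (trans (sym (rank-S ⊤)) (cong rN (S-⊤ t {n}))) ⟩
    t * dualRank M X + rN ⊤               ∎)
    where open ≡-Reasoning

  dual-isExpansion : IsExpansion t (dual M) (dual N)
  dual-isExpansion = cyclicFlat*⇒S , S-cyclicFlat* , λ A _ → dualRank-S A
    where
    cyclicFlat*⇒S : ∀ Z → IsCyclicFlat (dual N) Z → ∃ λ A → IsCyclicFlat (dual M) A × Z ≡ S[ t ] A
    cyclicFlat*⇒S Z cf with cyclicFlat⇒S (∁ Z) (isCyclicFlat-dual⇒∁ N cf)
    ... | A , cfA , ∁Z≡SA =
      ∁ A , ∁-isCyclicFlat⇒dual M (subst (IsCyclicFlat M) (sym (∁-involutive A)) cfA) , (begin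
        Z                 ≡⟨ ∁-involutive Z ⟨
        ∁ (∁ Z)           ≡⟨ cong ∁ ∁Z≡SA ⟩
        ∁ (S[ t ] A)      ≡⟨ S-∁ t A ⟨
        S[ t ] (∁ A)      ∎)
      where open ≡-Reasoning
    S-cyclicFlat* : ∀ A → IsCyclicFlat (dual M) A → IsCyclicFlat (dual N) (S[ t ] A)
    S-cyclicFlat* A cf = ∁-isCyclicFlat⇒dual N
      (subst (IsCyclicFlat N) (S-∁ t A) (S-cyclicFlat (∁ A) (isCyclicFlat-dual⇒∁ M cf)))

  module _ {k} {A : Fin k → Subset n} (presents : Presents rM A) where

    open TransversalProperties M {A} presents

    independent⇒hallCondition : ∀ {X} → rN X ≡ ∣ X ∣ → HallCondition (expand t A) X
    independent⇒hallCondition {X} independent U U⊆X = begin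
      ∣ U ∣                                ≤⟨ p⊆q⇒∣p∣≤∣q∣ U⊆X∩S[W] ⟩
      ∣ X ∩ S[ t ] W ∣                     ≤⟨ PN.independent⇒∣X∩Z∣≤r[Z] (S[ t ] W) independent ⟩
      rN (S[ t ] W)                        ≡⟨ rank-S W ⟩
      t * rM W                             ≤⟨ *-monoʳ-≤ t (r≤∣neighbours∣ W) ⟩
      t * ∣ neighbours A W ∣               ≡⟨ ∣S∣ t (neighbours A W) ⟨
      ∣ S[ t ] (neighbours A W) ∣          ≡⟨ cong ∣_∣ (neighbours-expand t A U) ⟨
      ∣ neighbours (expand t A) U ∣        ∎
      where
      open ≤-Reasoning
      W = blocks t U
      U⊆X∩S[W] : U ⊆ X ∩ S[ t ] W
      U⊆X∩S[W] j∈U = x∈p∩q⁺ (U⊆X j∈U , ∈-S⁺ t W (∈-blocks⁺ t U j∈U))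

    partialTransversal⇒independent : ∀ {X} → PartialTransversal (expand t A) X → rN X ≡ ∣ X ∣
    partialTransversal⇒independent {X} pt with PN.∃-cyclicFlat-witness X
    ... | Z , cfZ , wZ with cyclicFlat⇒S Z cfZ
    ... | A₀ , _ , refl with ∃-deficientSubset A₀
    ... | U , _ , deficient = ≤-antisym (rank-bound N X) (begin
      ∣ X ∣                                    ≡⟨ ∣p∣≡∣p∩q∣+∣p─q∣ X (S[ t ] A₀) ⟩
      ∣ X ∩ S[ t ] A₀ ∣ + ∣ X ─ S[ t ] A₀ ∣    ≤⟨ +-monoˡ-≤ _ ∣X∩S[A₀]∣≤ ⟩
      rN (S[ t ] A₀) + ∣ X ─ S[ t ] A₀ ∣       ≤⟨ wZ ⟩
      rN X                                     ∎)
      where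
      open ≤-Reasoning
      V = X ∩ S[ t ] U
      cover : X ∩ S[ t ] A₀ ⊆ S[ t ] (A₀ ─ U) ∪ V
      cover {j} j∈ with x∈p∩q⁻ X (S[ t ] A₀) j∈ | quotient t j ∈? U
      ... | j∈X , _    | yes q∈U = x∈p∪q⁺ (inj₂ (x∈p∩q⁺ (j∈X , ∈-S⁺ t U q∈U)))
      ... | _   , j∈SA | no  q∉U = x∈p∪q⁺ (inj₁ (∈-S⁺ t (A₀ ─ U) (x∈p∧x∉q⇒x∈p─q (∈-S⁻ t A₀ j∈SA) q∉U)))
      ∣V∣≤ : ∣ V ∣ ≤ t * ∣ neighbours A U ∣
      ∣V∣≤ = begin
        ∣ V ∣                                  ≤⟨ partialTransversal⇒hallCondition pt V (p∩q⊆p X _) ⟩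
        ∣ neighbours (expand t A) V ∣          ≡⟨ cong ∣_∣ (neighbours-expand t A V) ⟩
        ∣ S[ t ] (neighbours A (blocks t V)) ∣ ≤⟨ p⊆q⇒∣p∣≤∣q∣ (S-mono t (neighbours-mono A (blocks-⊆ t (p∩q⊆q X _)))) ⟩
        ∣ S[ t ] (neighbours A U) ∣            ≡⟨ ∣S∣ t (neighbours A U) ⟩
        t * ∣ neighbours A U ∣                 ∎
      ∣X∩S[A₀]∣≤ : ∣ X ∩ S[ t ] A₀ ∣ ≤ rN (S[ t ] A₀)
      ∣X∩S[A₀]∣≤ = begin
        ∣ X ∩ S[ t ] A₀ ∣                        ≤⟨ p⊆q⇒∣p∣≤∣q∣ cover ⟩
        ∣ S[ t ] (A₀ ─ U) ∪ V ∣                  ≤⟨ ∣p∪q∣≤∣p∣+∣q∣ (S[ t ] (A₀ ─ U)) V ⟩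
        ∣ S[ t ] (A₀ ─ U) ∣ + ∣ V ∣              ≤⟨ +-mono-≤ (≤-reflexive (∣S∣ t (A₀ ─ U))) ∣V∣≤ ⟩
        t * ∣ A₀ ─ U ∣ + t * ∣ neighbours A U ∣  ≡⟨ *-distribˡ-+ t _ _ ⟨
        t * (∣ A₀ ─ U ∣ + ∣ neighbours A U ∣)    ≤⟨ *-monoʳ-≤ t deficient ⟩
        t * rM A₀                                ≡⟨ rank-S A₀ ⟨
        rN (S[ t ] A₀)                           ∎

    transversal : Transversal N
    transversal = k * t , expand t A , λ X →
      (λ independent → HallTheorem.hall X default′ (expand t A) (independent⇒hallCondition independent)) ,
      partialTransversal⇒independent
      where
      default′ : Fin (n * t) → Fin (k * t)
      default′ j = combine (default (quotient t j)) (remainder {n} t j)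

transversal-expansion : ∀ {n} t (M : Matroid n) (N : Matroid (n * t)) →
                        IsExpansion t M N → Transversal M → Transversal N
transversal-expansion t M N exp (_ , A , presents) = Expansion.transversal t M N exp {A = A} presents

corollary3p12 : ∀ (n t : ℕ) (M : Matroid n) (N : Matroid (n * t)) →
    IsExpansion t M N →
    (Transversal M → Transversal N) × (Cotransversal M → Cotransversal N)
corollary3p12 n t M N exp =
  transversal-expansion t M N exp ,
  transversal-expansion t (dual M) (dual N) (Expansion.dual-isExpansion t M N exp)
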